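{- Let $T=\{1234,1243,3412\}$. For $n\ge3$, the number of permutations $\pi\in S_n(T)$ whose first letter is at most $n-2$, whose leftmost ascent top is $n$, and whose initial descent sequence consists of a set of consecutive integers, is $$(n-5)2^{n-1}+\binom{n+1}{2}+3.$$
   Context: $S_n(T)$ is the set of permutations of $[n]$ avoiding every pattern in $T$ (a permutation avoids $\tau$ if no subsequence is order-isomorphic to $\tau$). For $\pi=\pi_1\cdots\pi_n$, an ascent is an index $i$ with $\pi_i<\pi_{i+1}$; the leftmost ascent is the smallest such index $j$, and $\pi_{j+1}$ is the leftmost ascent top. The initial descent sequence of $\pi$ with leftmost ascent at index $j$ is the prefix $\pi_1\cdots\pi_j$. -}

module Defs where

open import Data.Nat using (ℕ; zero; suc; _+_; _<_; _≤_; _∸_)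
open import Data.List using (List; []; _∷_; _++_; length; take; applyUpTo)
open import Data.List.Membership.Propositional using (_∈_)
open import Data.List.Relation.Binary.Permutation.Propositional using (_↭_)
open import Data.Fin using (Fin; toℕ)
open import Data.Fin.Base using () renaming (_<_ to _<ᶠ_)
open import Data.List.Base using (lookup)
open import Data.Product using (Σ; ∃; ∃-syntax; _×_)
open import Relation.Nullary using (¬_)
open import Relation.Binary.PropositionalEquality using (_≡_)
open import Function.Bundles using (_⇔_)

-- Permutations of [n] = {1,…,n}, written in one-line notation as lists:
-- π is a permutation of [n] iff it is a rearrangement of the list 1,2,…,n.
IsPerm : ℕ → List ℕ → Set
IsPerm n π = π ↭ applyUpTo suc n

Contains : List ℕ → List ℕ → Set
Contains π τ =
  Σ (Fin (length τ) → Fin (length π)) λ f →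
    (∀ i j → i <ᶠ j → f i <ᶠ f j) ×
    (∀ i j → (lookup τ i < lookup τ j) ⇔ (lookup π (f i) < lookup π (f j)))

Avoids : List (List ℕ) → List ℕ → Set
Avoids T π = ∀ τ → τ ∈ T → ¬ Contains π τ

-- At π i x : the letter of π in (1-based) position i is x.
At : List ℕ → ℕ → ℕ → Set
At π i x = ∃[ pre ] ∃[ suf ] (π ≡ pre ++ x ∷ suf × suc (length pre) ≡ i)

Ascent : List ℕ → ℕ → Set
Ascent π i = ∃[ a ] ∃[ b ] (At π i a × At π (suc i) b × a < b)

LeftmostAscent : List ℕ → ℕ → Set
LeftmostAscent π j = Ascent π j × (∀ i → Ascent π i → j ≤ i)

ConsecutiveSet : List ℕ → Set
ConsecutiveSet L = ∃[ a ] (L ↭ applyUpTo (a +_) (length L))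

T : List (List ℕ)
T = (1 ∷ 2 ∷ 3 ∷ 4 ∷ []) ∷ (1 ∷ 2 ∷ 4 ∷ 3 ∷ []) ∷ (3 ∷ 4 ∷ 1 ∷ 2 ∷ []) ∷ []

Counted : ℕ → List ℕ → Set
Counted n π =
  IsPerm n π × Avoids T π ×
  (∃[ x ] ∃[ rest ] (π ≡ x ∷ rest × x ≤ n ∸ 2)) ×
  (∃[ j ] (LeftmostAscent π j × At π (suc j) n × ConsecutiveSet (take j π)))

-- Such a π is exactly  π = D ++ n ∷ R,  where the initial descent
-- sequence D = m, m−1, …, a (1 ≤ a ≤ m ≤ n − 2) is a decreasing run of consecutive
-- integers, and the tail R is a rearrangement of the "small" letters
-- S = {1, …, a−1} and the "big" letters B = {m+1, …, n−1}.  Given D, avoiding T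
-- is a condition on R alone, which an explicit grammar captures: R is written
-- letter by letter, each step choosing the largest remaining small letter, the
-- largest remaining big letter, or the second largest remaining big letter r; in
-- the last case the largest big letter c becomes "pending": each later step
-- writes the largest remaining small or big letter, or c itself, after which
-- the remaining letters follow in decreasing order.
module Submission where

import Data.Nat

module Subsequences where

  open import Data.Nat using (ℕ)
  open import Data.List using (List; []; _∷_; _++_)
  open import Data.List.Membership.Propositional using (_∈_)
  open import Data.List.Membership.Propositional.Properties using (∈-++⁻)
  open import Data.List.Relation.Unary.Any using (here; there)
  open import Data.List.Relation.Binary.Sublist.Propositional public
    using (_⊆_; []; _∷_; _∷ʳ_; minimum; ⊆-trans; to∈; from∈)
  open import Data.List.Relation.Binary.Sublist.Propositional.Properties public
    using (++⁺; ++⁺ˡ; ++⁺ʳ)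
  open import Data.Product using (∃-syntax; _×_; _,_)
  open import Data.Sum using (_⊎_; inj₁; inj₂; map₂)
  open import Relation.Binary.PropositionalEquality using (_≡_; _≢_; refl)
  open import Data.Empty using (⊥-elim)

  snoc-split : ∀ (P : List ℕ) {ys x} → ys ⊆ (P ++ x ∷ []) →
               ys ⊆ P ⊎ ∃[ ys' ] (ys ≡ ys' ++ x ∷ [] × ys' ⊆ P)
  snoc-split [] (_ ∷ʳ []) = inj₁ []
  snoc-split [] (refl ∷ []) = inj₂ ([] , refl , [])
  snoc-split (y ∷ P) (.y ∷ʳ s) with snoc-split P s
  ... | inj₁ t = inj₁ (y ∷ʳ t)
  ... | inj₂ (ys' , e , t) = inj₂ (ys' , e , y ∷ʳ t)
  snoc-split (y ∷ P) (refl ∷ s) with snoc-split P s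
  ... | inj₁ t = inj₁ (refl ∷ t)
  ... | inj₂ (ys' , refl , t) = inj₂ (y ∷ ys' , refl , refl ∷ t)

  snoc-mem : ∀ (P : List ℕ) {y x} → y ∈ (P ++ x ∷ []) → y ∈ P ⊎ y ≡ x
  snoc-mem P m = map₂ (λ { (here e) → e }) (∈-++⁻ P m)

  snoc-pair : ∀ (P : List ℕ) {p q x} → (p ∷ q ∷ []) ⊆ (P ++ x ∷ []) →
              (p ∷ q ∷ []) ⊆ P ⊎ (q ≡ x × p ∈ P)
  snoc-pair P s with snoc-split P s
  ... | inj₁ t = inj₁ t
  ... | inj₂ (_ ∷ [] , refl , t) = inj₂ (refl , to∈ t)
  ... | inj₂ ([] , () , _)
  ... | inj₂ (_ ∷ _ ∷ [] , () , _)
  ... | inj₂ (_ ∷ _ ∷ _ ∷ _ , () , _)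

  snoc-quad : ∀ (P : List ℕ) {p q r s x} → (p ∷ q ∷ r ∷ s ∷ []) ⊆ (P ++ x ∷ []) →
              (p ∷ q ∷ r ∷ s ∷ []) ⊆ P ⊎ (s ≡ x × (p ∷ q ∷ r ∷ []) ⊆ P)
  snoc-quad P s with snoc-split P s
  ... | inj₁ t = inj₁ t
  ... | inj₂ (_ ∷ _ ∷ _ ∷ [] , refl , t) = inj₂ (refl , t)
  ... | inj₂ ([] , () , _)
  ... | inj₂ (_ ∷ [] , () , _)
  ... | inj₂ (_ ∷ _ ∷ [] , () , _)
  ... | inj₂ (_ ∷ _ ∷ _ ∷ _ ∷ [] , () , _)
  ... | inj₂ (_ ∷ _ ∷ _ ∷ _ ∷ _ ∷ _ , () , _)

  pair₁₂ : ∀ {p q r : ℕ} {P} → (p ∷ q ∷ r ∷ []) ⊆ P → (p ∷ q ∷ []) ⊆ P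
  pair₁₂ = ⊆-trans (refl ∷ refl ∷ _ ∷ʳ [])

  pair₂₃ : ∀ {p q r : ℕ} {P} → (p ∷ q ∷ r ∷ []) ⊆ P → (q ∷ r ∷ []) ⊆ P
  pair₂₃ = ⊆-trans (_ ∷ʳ refl ∷ refl ∷ [])

  third : ∀ {p q r : ℕ} {P} → (p ∷ q ∷ r ∷ []) ⊆ P → r ∈ P
  third s = to∈ (⊆-trans (_ ∷ʳ _ ∷ʳ refl ∷ []) s)

  order : ∀ {L : List ℕ} {u v} → u ∈ L → v ∈ L → u ≢ v →
          (u ∷ v ∷ []) ⊆ L ⊎ (v ∷ u ∷ []) ⊆ L
  order (here refl) (here refl) u≢v = ⊥-elim (u≢v refl)
  order {x ∷ _} (here refl) (there v∈) _ = inj₁ (refl ∷ from∈ v∈)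
  order {x ∷ _} (there u∈) (here refl) _ = inj₂ (refl ∷ from∈ u∈)
  order {x ∷ _} (there u∈) (there v∈) u≢v with order u∈ v∈ u≢v
  ... | inj₁ s = inj₁ (x ∷ʳ s)
  ... | inj₂ s = inj₂ (x ∷ʳ s)

module Descending where

  open Subsequences
  open import Data.Nat using (ℕ; _<_)
  open import Data.Nat.Properties using (<-irrefl; <-asym; <-trans; <-cmp)
  open import Data.List using (List; []; _∷_; _++_)
  open import Data.List.Membership.Propositional using (_∈_)
  open import Data.List.Membership.Propositional.Properties using (∈-++⁻)
  open import Data.List.Relation.Unary.Any using (here; there)
  import Data.List.Relation.Unary.All as All
  open import Data.List.Relation.Unary.AllPairs using (AllPairs; []; _∷_)
  import Data.List.Relation.Unary.AllPairs as AllPairs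
  open import Data.List.Relation.Unary.Unique.Propositional using (Unique)
  open import Data.Sum using (inj₁; inj₂)
  open import Data.Empty using (⊥-elim)
  open import Relation.Binary.PropositionalEquality using (_≡_; refl; sym; cong)
  open import Relation.Binary.Definitions using (tri<; tri≈; tri>)
  open import Relation.Nullary using (¬_)

  Desc : List ℕ → Set
  Desc = AllPairs (λ x y → y < x)

  desc-head : ∀ {x l y} → Desc (x ∷ l) → y ∈ l → y < x
  desc-head (x> ∷ _) = All.lookup x>

  desc-pair : ∀ {L p q} → Desc L → (p ∷ q ∷ []) ⊆ L → q < p
  desc-pair (_ ∷ d) (_ ∷ʳ s) = desc-pair d s
  desc-pair d (refl ∷ s) = desc-head d (to∈ s)

  desc⇒unique : ∀ {L} → Desc L → Unique L
  desc⇒unique [] = []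
  desc⇒unique (x> ∷ d) = All.map (λ lt e → <-irrefl (sym e) lt) x> ∷ desc⇒unique d

  desc-from-pairs : ∀ {L} → Unique L → (∀ {u v} → (u ∷ v ∷ []) ⊆ L → ¬ u < v) → Desc L
  desc-from-pairs {[]} _ _ = []
  desc-from-pairs {x ∷ L} (x∉ ∷ u) noAsc =
    All.tabulate below ∷ desc-from-pairs u (λ s → noAsc (x ∷ʳ s))
    where
    below : ∀ {y} → y ∈ L → y < x
    below {y} y∈ with <-cmp y x
    ... | tri< lt _ _ = lt
    ... | tri≈ _ e _ = ⊥-elim (All.lookup x∉ y∈ (sym e))
    ... | tri> _ _ gt = ⊥-elim (noAsc (refl ∷ from∈ y∈) gt)

  desc-from-adjacent : ∀ (P : List ℕ) → Unique P →
    (∀ P₁ u v P₂ → P ≡ P₁ ++ u ∷ v ∷ P₂ → ¬ u < v) → Desc P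
  desc-from-adjacent [] _ _ = []
  desc-from-adjacent (x ∷ []) _ _ = All.[] ∷ []
  desc-from-adjacent (x ∷ y ∷ l) (x∉ ∷ u) noAsc =
    (y<x All.∷ All.map (λ z<y → <-trans z<y y<x) (AllPairs.head dy)) ∷ dy
    where
    y<x : y < x
    y<x with <-cmp x y
    ... | tri< lt _ _ = ⊥-elim (noAsc [] x y l refl lt)
    ... | tri≈ _ e _ = ⊥-elim (All.lookup x∉ (here refl) e)
    ... | tri> _ _ gt = gt
    dy : Desc (y ∷ l)
    dy = desc-from-adjacent (y ∷ l) u (λ P₁ u' v' P₂ e → noAsc (x ∷ P₁) u' v' P₂ (cong (x ∷_) e))

  desc-ext : ∀ {A B} → Desc A → Desc B → (∀ {x} → x ∈ A → x ∈ B) → (∀ {x} → x ∈ B → x ∈ A) → A ≡ B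
  desc-ext {[]} {[]} _ _ _ _ = refl
  desc-ext {[]} {b ∷ B} _ _ _ g with g (here refl)
  ... | ()
  desc-ext {a ∷ A} {[]} _ _ f _ with f (here refl)
  ... | ()
  desc-ext {a ∷ A} {b ∷ B} dA dB f g with sameHead
    where
    sameHead : a ≡ b
    sameHead with f (here refl) | g (here refl)
    ... | here e | _ = e
    ... | _ | here e = sym e
    ... | there a∈B | there b∈A = ⊥-elim (<-asym (desc-head dB a∈B) (desc-head dA b∈A))
  ... | refl = cong (a ∷_) (desc-ext (AllPairs.tail dA) (AllPairs.tail dB) f' g')
    where
    f' : ∀ {x} → x ∈ A → x ∈ B
    f' x∈ with f (there x∈)
    ... | here refl = ⊥-elim (<-irrefl refl (desc-head dA x∈))
    ... | there q = q
    g' : ∀ {x} → x ∈ B → x ∈ A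
    g' x∈ with g (there x∈)
    ... | here refl = ⊥-elim (<-irrefl refl (desc-head dB x∈))
    ... | there q = q

  desc-++ : ∀ {A B} → Desc A → Desc B → (∀ {x y} → x ∈ A → y ∈ B → y < x) → Desc (A ++ B)
  desc-++ {[]} _ dB _ = dB
  desc-++ {x ∷ A} {B} (x> ∷ dA) dB above =
    All.tabulate below ∷ desc-++ dA dB (λ x∈ → above (there x∈))
    where
    below : ∀ {y} → y ∈ A ++ B → y < x
    below y∈ with ∈-++⁻ A y∈
    ... | inj₁ y∈A = All.lookup x> y∈A
    ... | inj₂ y∈B = above (here refl) y∈B

module Patterns where

  open import Defs using (T; Contains; Avoids)
  open Subsequences
  open Descending
  open import Data.Nat using (ℕ; zero; suc; _<_; z≤n; s≤s)
  open import Data.Nat.Properties using (<-asym; <-irrefl; <-trans; <-cmp; ≤-pred; n<1+n)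
  open import Data.List using (List; []; _∷_; _++_; length; tabulate; lookup)
  open import Data.List.Properties using (tabulate-cong)
  open import Data.List.Membership.Propositional.Properties using (∈-lookup)
  open import Data.List.Relation.Unary.Any using (here; there)
  import Data.List.Relation.Unary.All as All
  open import Data.List.Relation.Unary.Unique.Propositional using (Unique)
  open import Data.List.Relation.Unary.AllPairs using (_∷_)
  open import Data.List.Relation.Unary.Unique.DecPropositional Data.Nat._≟_ using (unique?)
  open import Data.Fin using (Fin; toℕ) renaming (zero to fz; suc to fs)
  open import Data.Fin.Base using () renaming (_<_ to _<ᶠ_)
  open import Data.Product using (_×_; _,_; proj₁)
  open import Data.Sum using (_⊎_; inj₁; inj₂)
  open import Data.Empty using (⊥-elim)
  open import Function using (_∘_)
  open import Function.Bundles using (_⇔_; mk⇔; Equivalence)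
  open import Relation.Binary.PropositionalEquality using (_≡_; refl; sym; cong; cong₂; subst; subst₂)
  open import Relation.Binary.Definitions using (tri<; tri≈; tri>)
  open import Relation.Nullary using (¬_)
  open import Relation.Nullary.Decidable using (from-yes)

  -- x y z w has one of the shapes 1234, 1243, 3412.
  Bad : ℕ → ℕ → ℕ → ℕ → Set
  Bad x y z w = (x < y × y < z × z < w) ⊎ (x < y × y < w × w < z) ⊎ (z < w × w < x × x < y)

  bad⇒ascent : ∀ {x y z w} → Bad x y z w → x < y
  bad⇒ascent (inj₁ (x<y , _)) = x<y
  bad⇒ascent (inj₂ (inj₁ (x<y , _))) = x<y
  bad⇒ascent (inj₂ (inj₂ (_ , _ , x<y))) = x<y

  Av : List ℕ → Set
  Av π = ∀ {x y z w} → (x ∷ y ∷ z ∷ w ∷ []) ⊆ π → ¬ Bad x y z w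

  NoBadEnd : List ℕ → ℕ → Set
  NoBadEnd P x = ∀ {p q r} → (p ∷ q ∷ r ∷ []) ⊆ P → ¬ Bad p q r x

  -- Permutations are built by appending letters, checking only new shapes.
  av-snoc : ∀ (P : List ℕ) {x} → Av P → NoBadEnd P x → Av (P ++ x ∷ [])
  av-snoc P av noBad s bad with snoc-quad P s
  ... | inj₁ t = av t bad
  ... | inj₂ (refl , t) = noBad t bad

  desc-noBadEnd : ∀ {D x} → Desc D → NoBadEnd D x
  desc-noBadEnd d s bad = <-asym (bad⇒ascent bad) (desc-pair d (pair₁₂ s))

  desc-avoids : ∀ {D} → Desc D → Av D
  desc-avoids d s bad = <-asym (bad⇒ascent bad) (desc-pair d (⊆-trans (refl ∷ refl ∷ _ ∷ʳ _ ∷ʳ []) s))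

  shift-down : ∀ {m : ℕ} (p : Fin (suc m)) → 0 < toℕ p → Fin m
  shift-down (fs p) _ = p

  lookup-shift-down : ∀ (y : ℕ) (π : List ℕ) (p : Fin (suc (length π))) (0<p : 0 < toℕ p) →
    lookup (y ∷ π) p ≡ lookup π (shift-down p 0<p)
  lookup-shift-down y π (fs p) _ = refl

  shift-down-mono : ∀ {m : ℕ} {p q : Fin (suc m)} {0<p 0<q} → p <ᶠ q → shift-down p 0<p <ᶠ shift-down q 0<q
  shift-down-mono {p = fs p} {fs q} p<q = ≤-pred p<q

  positions⇒sublist : ∀ {k} (π : List ℕ) (f : Fin k → Fin (length π)) →
    (∀ i j → i <ᶠ j → f i <ᶠ f j) → tabulate (lookup π ∘ f) ⊆ π
  positions⇒sublist {zero} π f mono = minimum π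
  positions⇒sublist {suc k} [] f mono with f fz
  ... | ()
  positions⇒sublist {suc k} (y ∷ π) f mono = from-first (f fz) refl
    where
    from-first : (p : Fin (suc (length π))) → f fz ≡ p → tabulate (lookup (y ∷ π) ∘ f) ⊆ y ∷ π
    from-first fz eq = subst (_⊆ y ∷ π) (sym letters) (refl ∷ positions⇒sublist π g g-mono)
      where
      later : ∀ i → 0 < toℕ (f (fs i))
      later i = subst (λ p → toℕ p < toℕ (f (fs i))) eq (mono fz (fs i) (s≤s z≤n))
      g : Fin k → Fin (length π)
      g i = shift-down (f (fs i)) (later i)
      g-mono : ∀ i j → i <ᶠ j → g i <ᶠ g j
      g-mono i j i<j = shift-down-mono (mono (fs i) (fs j) (s≤s i<j))
      letters : tabulate (lookup (y ∷ π) ∘ f) ≡ y ∷ tabulate (lookup π ∘ g)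
      letters = cong₂ _∷_ (cong (lookup (y ∷ π)) eq) (tabulate-cong (λ i → lookup-shift-down y π _ (later i)))
    from-first (fs _) eq = subst (_⊆ y ∷ π) (sym letters) (y ∷ʳ positions⇒sublist π g g-mono)
      where
      positive : ∀ i → 0 < toℕ (f i)
      positive fz = subst (λ q → 0 < toℕ q) (sym eq) (s≤s z≤n)
      positive (fs i) = <-trans (positive fz) (mono fz (fs i) (s≤s z≤n))
      g : Fin (suc k) → Fin (length π)
      g i = shift-down (f i) (positive i)
      g-mono : ∀ i j → i <ᶠ j → g i <ᶠ g j
      g-mono i j i<j = shift-down-mono (mono i j i<j)
      letters : tabulate (lookup (y ∷ π) ∘ f) ≡ tabulate (lookup π ∘ g)
      letters = tabulate-cong (λ i → lookup-shift-down y π _ (positive i))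

  position : ∀ {xs ys : List ℕ} → xs ⊆ ys → Fin (length xs) → Fin (length ys)
  position (y ∷ʳ s) i = fs (position s i)
  position {_ ∷ _} (refl ∷ s) fz = fz
  position {_ ∷ _} (refl ∷ s) (fs i) = fs (position s i)

  position-mono : ∀ {xs ys} (s : xs ⊆ ys) i j → i <ᶠ j → position s i <ᶠ position s j
  position-mono (y ∷ʳ s) i j i<j = s≤s (position-mono s i j i<j)
  position-mono {_ ∷ _} (refl ∷ s) fz (fs j) _ = s≤s z≤n
  position-mono {_ ∷ _} (refl ∷ s) (fs i) (fs j) (s≤s i<j) = s≤s (position-mono s i j i<j)

  position-lookup : ∀ {xs ys} (s : xs ⊆ ys) i → lookup ys (position s i) ≡ lookup xs i
  position-lookup (y ∷ʳ s) i = position-lookup s i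
  position-lookup {_ ∷ _} (refl ∷ s) fz = refl
  position-lookup {_ ∷ _} (refl ∷ s) (fs i) = position-lookup s i

  order-iso : ∀ {k} (t v : Fin k → ℕ) → (∀ i j → t i < t j → v i < v j) →
    (∀ i j → t i ≡ t j → i ≡ j) → ∀ i j → (t i < t j) ⇔ (v i < v j)
  order-iso t v mono inj i j = mk⇔ (mono i j) back
    where
    back : v i < v j → t i < t j
    back vi<vj with <-cmp (t i) (t j)
    ... | tri< lt _ _ = lt
    ... | tri≈ _ e _ rewrite inj i j e = ⊥-elim (<-irrefl refl vi<vj)
    ... | tri> _ _ gt = ⊥-elim (<-asym vi<vj (mono j i gt))

  lookup-injective : ∀ {xs : List ℕ} → Unique xs → ∀ i j → lookup xs i ≡ lookup xs j → i ≡ j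
  lookup-injective {_ ∷ _} _ fz fz _ = refl
  lookup-injective {_ ∷ _} (x∉ ∷ _) fz (fs j) e = ⊥-elim (All.lookup x∉ (∈-lookup j) e)
  lookup-injective {_ ∷ _} (x∉ ∷ _) (fs i) fz e = ⊥-elim (All.lookup x∉ (∈-lookup i) (sym e))
  lookup-injective {_ ∷ _} (_ ∷ u) (fs i) (fs j) e = cong fs (lookup-injective u i j e)

  occurrence : ∀ {π x y z w} a b c d → (x ∷ y ∷ z ∷ w ∷ []) ⊆ π →
    (∀ i j → lookup (a ∷ b ∷ c ∷ d ∷ []) i < lookup (a ∷ b ∷ c ∷ d ∷ []) j →
             lookup (x ∷ y ∷ z ∷ w ∷ []) i < lookup (x ∷ y ∷ z ∷ w ∷ []) j) →
    Unique (a ∷ b ∷ c ∷ d ∷ []) → Contains π (a ∷ b ∷ c ∷ d ∷ [])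
  occurrence a b c d s mono u =
    position s , position-mono s , λ i j →
      subst₂ (λ p q → (lookup τ i < lookup τ j) ⇔ (p < q)) (sym (position-lookup s i)) (sym (position-lookup s j))
        (order-iso (lookup τ) (lookup (_ ∷ _ ∷ _ ∷ _ ∷ [])) mono (lookup-injective u) i j)
    where
    τ = a ∷ b ∷ c ∷ d ∷ []

  chain1234 : ∀ {x y z w} → x < y → y < z → z < w → ∀ i j →
    lookup (1 ∷ 2 ∷ 3 ∷ 4 ∷ []) i < lookup (1 ∷ 2 ∷ 3 ∷ 4 ∷ []) j →
    lookup (x ∷ y ∷ z ∷ w ∷ []) i < lookup (x ∷ y ∷ z ∷ w ∷ []) j
  chain1234 c1 c2 c3 fz fz (s≤s ())
  chain1234 c1 c2 c3 fz (fs fz) _ = c1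
  chain1234 c1 c2 c3 fz (fs (fs fz)) _ = <-trans c1 c2
  chain1234 c1 c2 c3 fz (fs (fs (fs fz))) _ = <-trans (<-trans c1 c2) c3
  chain1234 c1 c2 c3 (fs fz) fz (s≤s ())
  chain1234 c1 c2 c3 (fs fz) (fs fz) (s≤s (s≤s ()))
  chain1234 c1 c2 c3 (fs fz) (fs (fs fz)) _ = c2
  chain1234 c1 c2 c3 (fs fz) (fs (fs (fs fz))) _ = <-trans c2 c3
  chain1234 c1 c2 c3 (fs (fs fz)) fz (s≤s ())
  chain1234 c1 c2 c3 (fs (fs fz)) (fs fz) (s≤s (s≤s ()))
  chain1234 c1 c2 c3 (fs (fs fz)) (fs (fs fz)) (s≤s (s≤s (s≤s ())))
  chain1234 c1 c2 c3 (fs (fs fz)) (fs (fs (fs fz))) _ = c3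
  chain1234 c1 c2 c3 (fs (fs (fs fz))) fz (s≤s ())
  chain1234 c1 c2 c3 (fs (fs (fs fz))) (fs fz) (s≤s (s≤s ()))
  chain1234 c1 c2 c3 (fs (fs (fs fz))) (fs (fs fz)) (s≤s (s≤s (s≤s ())))
  chain1234 c1 c2 c3 (fs (fs (fs fz))) (fs (fs (fs fz))) (s≤s (s≤s (s≤s (s≤s ()))))

  chain1243 : ∀ {x y z w} → x < y → y < w → w < z → ∀ i j →
    lookup (1 ∷ 2 ∷ 4 ∷ 3 ∷ []) i < lookup (1 ∷ 2 ∷ 4 ∷ 3 ∷ []) j →
    lookup (x ∷ y ∷ z ∷ w ∷ []) i < lookup (x ∷ y ∷ z ∷ w ∷ []) j
  chain1243 c1 c2 c3 fz fz (s≤s ())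
  chain1243 c1 c2 c3 fz (fs fz) _ = c1
  chain1243 c1 c2 c3 fz (fs (fs fz)) _ = <-trans (<-trans c1 c2) c3
  chain1243 c1 c2 c3 fz (fs (fs (fs fz))) _ = <-trans c1 c2
  chain1243 c1 c2 c3 (fs fz) fz (s≤s ())
  chain1243 c1 c2 c3 (fs fz) (fs fz) (s≤s (s≤s ()))
  chain1243 c1 c2 c3 (fs fz) (fs (fs fz)) _ = <-trans c2 c3
  chain1243 c1 c2 c3 (fs fz) (fs (fs (fs fz))) _ = c2
  chain1243 c1 c2 c3 (fs (fs fz)) fz (s≤s ())
  chain1243 c1 c2 c3 (fs (fs fz)) (fs fz) (s≤s (s≤s ()))
  chain1243 c1 c2 c3 (fs (fs fz)) (fs (fs fz)) (s≤s (s≤s (s≤s (s≤s ()))))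
  chain1243 c1 c2 c3 (fs (fs fz)) (fs (fs (fs fz))) (s≤s (s≤s (s≤s ())))
  chain1243 c1 c2 c3 (fs (fs (fs fz))) fz (s≤s ())
  chain1243 c1 c2 c3 (fs (fs (fs fz))) (fs fz) (s≤s (s≤s ()))
  chain1243 c1 c2 c3 (fs (fs (fs fz))) (fs (fs fz)) _ = c3
  chain1243 c1 c2 c3 (fs (fs (fs fz))) (fs (fs (fs fz))) (s≤s (s≤s (s≤s ())))

  chain3412 : ∀ {x y z w} → z < w → w < x → x < y → ∀ i j →
    lookup (3 ∷ 4 ∷ 1 ∷ 2 ∷ []) i < lookup (3 ∷ 4 ∷ 1 ∷ 2 ∷ []) j →
    lookup (x ∷ y ∷ z ∷ w ∷ []) i < lookup (x ∷ y ∷ z ∷ w ∷ []) j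
  chain3412 c1 c2 c3 fz fz (s≤s (s≤s (s≤s ())))
  chain3412 c1 c2 c3 fz (fs fz) _ = c3
  chain3412 c1 c2 c3 fz (fs (fs fz)) (s≤s ())
  chain3412 c1 c2 c3 fz (fs (fs (fs fz))) (s≤s (s≤s ()))
  chain3412 c1 c2 c3 (fs fz) fz (s≤s (s≤s (s≤s ())))
  chain3412 c1 c2 c3 (fs fz) (fs fz) (s≤s (s≤s (s≤s (s≤s ()))))
  chain3412 c1 c2 c3 (fs fz) (fs (fs fz)) (s≤s ())
  chain3412 c1 c2 c3 (fs fz) (fs (fs (fs fz))) (s≤s (s≤s ()))
  chain3412 c1 c2 c3 (fs (fs fz)) fz _ = <-trans c1 c2
  chain3412 c1 c2 c3 (fs (fs fz)) (fs fz) _ = <-trans (<-trans c1 c2) c3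
  chain3412 c1 c2 c3 (fs (fs fz)) (fs (fs fz)) (s≤s ())
  chain3412 c1 c2 c3 (fs (fs fz)) (fs (fs (fs fz))) _ = c1
  chain3412 c1 c2 c3 (fs (fs (fs fz))) fz _ = c2
  chain3412 c1 c2 c3 (fs (fs (fs fz))) (fs fz) _ = <-trans c2 c3
  chain3412 c1 c2 c3 (fs (fs (fs fz))) (fs (fs fz)) (s≤s ())
  chain3412 c1 c2 c3 (fs (fs (fs fz))) (fs (fs (fs fz))) (s≤s (s≤s ()))

  avoids⇒Av : ∀ {π} → Avoids T π → Av π
  avoids⇒Av av s (inj₁ (c1 , c2 , c3)) =
    av _ (here refl)
       (occurrence 1 2 3 4 s (chain1234 c1 c2 c3) (from-yes (unique? (1 ∷ 2 ∷ 3 ∷ 4 ∷ []))))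
  avoids⇒Av av s (inj₂ (inj₁ (c1 , c2 , c3))) =
    av _ (there (here refl))
       (occurrence 1 2 4 3 s (chain1243 c1 c2 c3) (from-yes (unique? (1 ∷ 2 ∷ 4 ∷ 3 ∷ []))))
  avoids⇒Av av s (inj₂ (inj₂ (c1 , c2 , c3))) =
    av _ (there (there (here refl)))
       (occurrence 3 4 1 2 s (chain3412 c1 c2 c3) (from-yes (unique? (3 ∷ 4 ∷ 1 ∷ 2 ∷ []))))

  ordered : ∀ π {τ} (occ : Contains π τ) i j →
    lookup τ i < lookup τ j → lookup π (proj₁ occ i) < lookup π (proj₁ occ j)
  ordered π (_ , _ , iso) i j = Equivalence.to (iso i j)

  Av⇒avoids : ∀ {π} → Av π → Avoids T π
  Av⇒avoids {π} av ._ (here refl) occ@(f , mono , _) =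
    av (positions⇒sublist π f mono)
       (inj₁ (asc fz (fs fz) (n<1+n _) , asc (fs fz) (fs (fs fz)) (n<1+n _) ,
              asc (fs (fs fz)) (fs (fs (fs fz))) (n<1+n _)))
    where asc = ordered π occ
  Av⇒avoids {π} av ._ (there (here refl)) occ@(f , mono , _) =
    av (positions⇒sublist π f mono)
       (inj₂ (inj₁ (asc fz (fs fz) (n<1+n _) , asc (fs fz) (fs (fs (fs fz))) (n<1+n _) ,
                    asc (fs (fs (fs fz))) (fs (fs fz)) (n<1+n _))))
    where asc = ordered π occ
  Av⇒avoids {π} av ._ (there (there (here refl))) occ@(f , mono , _) =
    av (positions⇒sublist π f mono)
       (inj₂ (inj₂ (asc (fs (fs fz)) (fs (fs (fs fz))) (n<1+n _) , asc (fs (fs (fs fz))) fz (n<1+n _) ,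
                    asc fz (fs fz) (n<1+n _))))
    where asc = ordered π occ
module Intervals where

  open Descending
  open import Data.Nat using (ℕ; zero; suc; _+_; _∸_; _<_; _≤_)
  open import Data.Nat.Properties
  open import Data.List using (List; []; _∷_; _++_; applyUpTo; applyDownFrom)
  open import Data.List.Membership.Propositional using (_∈_)
  open import Data.List.Membership.Propositional.Properties using (∈-∃++; ∈-applyUpTo⁺; ∈-applyUpTo⁻)
  open import Data.List.Relation.Unary.Any using (here; there)
  import Data.List.Relation.Unary.All as All
  open import Data.List.Relation.Unary.AllPairs using ([]; _∷_)
  open import Data.List.Relation.Unary.Unique.Propositional using (Unique)
  open import Data.List.Relation.Unary.Unique.Propositional.Properties using (applyUpTo⁺₁)
  open import Data.List.Relation.Binary.Permutation.Propositional using (_↭_; ↭-refl; ↭-trans; ↭-sym; prep; ↭⇒↭ₛ)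
  open import Data.List.Relation.Binary.Permutation.Propositional.Properties using (∈-resp-↭; shift)
  open import Data.List.Relation.Binary.Permutation.Setoid.Properties using (Unique-resp-↭)
  open import Data.Product using (_×_; _,_; proj₁; proj₂)
  open import Data.Empty using (⊥-elim)
  open import Relation.Binary.PropositionalEquality using (_≡_; refl; sym; cong; cong₂; subst; setoid)
  open import Relation.Nullary using (yes; no)

  -- down lo k = lo+k−1, …, lo+1, lo.
  down : ℕ → ℕ → List ℕ
  down lo = applyDownFrom (lo +_)

  ∈-down⁻ : ∀ {lo k y} → y ∈ down lo k → lo ≤ y × y < lo + k
  ∈-down⁻ {lo} {suc k} (here refl) = m≤m+n lo k , +-monoʳ-< lo (n<1+n k)
  ∈-down⁻ {lo} {suc k} (there y∈) with ∈-down⁻ {lo} {k} y∈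
  ... | lo≤y , y< = lo≤y , <-trans y< (+-monoʳ-< lo (n<1+n k))

  ∈-down⁺ : ∀ {lo k y} → lo ≤ y → y < lo + k → y ∈ down lo k
  ∈-down⁺ {lo} {zero} {y} lo≤y y< = ⊥-elim (<⇒≱ y< (subst (_≤ y) (sym (+-identityʳ lo)) lo≤y))
  ∈-down⁺ {lo} {suc k} {y} lo≤y y< with y ≟ lo + k
  ... | yes refl = here refl
  ... | no y≢ = there (∈-down⁺ lo≤y (≤∧≢⇒< (≤-pred (subst (y <_) (+-suc lo k) y<)) y≢))

  down-desc : ∀ lo k → Desc (down lo k)
  down-desc lo zero = []
  down-desc lo (suc k) = All.tabulate (λ y∈ → proj₂ (∈-down⁻ y∈)) ∷ down-desc lo k

  down-last : ∀ a j → down a (suc j) ≡ down (suc a) j ++ a ∷ []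
  down-last a zero = cong (_∷ []) (+-identityʳ a)
  down-last a (suc j) = cong₂ _∷_ (+-suc a j) (down-last a j)

  ∈-upTo⁻ : ∀ {a k y} → y ∈ applyUpTo (a +_) k → a ≤ y × y < a + k
  ∈-upTo⁻ {a} y∈ with ∈-applyUpTo⁻ (a +_) y∈
  ... | i , i<k , refl = m≤m+n a i , +-monoʳ-< a i<k

  ∈-upTo⁺ : ∀ {a k y} → a ≤ y → y < a + k → y ∈ applyUpTo (a +_) k
  ∈-upTo⁺ {a} {k} {y} a≤y y< =
    subst (_∈ applyUpTo (a +_) k) (m+[n∸m]≡n a≤y)
      (∈-applyUpTo⁺ (a +_) (+-cancelˡ-< a (y ∸ a) k (subst (_< a + k) (sym (m+[n∸m]≡n a≤y)) y<)))

  upTo-unique : ∀ a k → Unique (applyUpTo (a +_) k)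
  upTo-unique a k = applyUpTo⁺₁ (a +_) k (λ i<j _ e → <-irrefl (+-cancelˡ-≡ a _ _ e) i<j)

  unique-resp-↭ : ∀ {xs ys : List ℕ} → xs ↭ ys → Unique xs → Unique ys
  unique-resp-↭ p = Unique-resp-↭ (setoid ℕ) (↭⇒↭ₛ p)

  same-members⇒↭ : ∀ (xs ys : List ℕ) → Unique xs → Unique ys →
    (∀ {z} → z ∈ xs → z ∈ ys) → (∀ {z} → z ∈ ys → z ∈ xs) → xs ↭ ys
  same-members⇒↭ [] [] _ _ _ _ = ↭-refl
  same-members⇒↭ [] (y ∷ ys) _ _ _ g with g (here refl)
  ... | ()
  same-members⇒↭ (x ∷ xs) ys (x∉ ∷ uxs) uys f g with ∈-∃++ (f (here refl))
  ... | ys₁ , ys₂ , refl = ↭-trans (prep x (same-members⇒↭ xs (ys₁ ++ ys₂) uxs (tail-unique u) f' g')) (↭-sym σ)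
    where
    σ : ys₁ ++ x ∷ ys₂ ↭ x ∷ (ys₁ ++ ys₂)
    σ = shift x ys₁ ys₂
    u : Unique (x ∷ (ys₁ ++ ys₂))
    u = unique-resp-↭ σ uys
    tail-unique : ∀ {z zs} → Unique (z ∷ zs) → Unique zs
    tail-unique (_ ∷ t) = t
    f' : ∀ {z} → z ∈ xs → z ∈ ys₁ ++ ys₂
    f' z∈ with ∈-resp-↭ σ (f (there z∈))
    ... | here e = ⊥-elim (All.lookup x∉ z∈ (sym e))
    ... | there q = q
    g' : ∀ {z} → z ∈ ys₁ ++ ys₂ → z ∈ xs
    g' z∈ with g (∈-resp-↭ (↭-sym σ) (there z∈)) | u
    ... | here refl | x∉' ∷ _ = ⊥-elim (All.lookup x∉' z∈ refl)
    ... | there q | _ = q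

  down↭upTo : ∀ a k → down a k ↭ applyUpTo (a +_) k
  down↭upTo a k = same-members⇒↭ (down a k) (applyUpTo (a +_) k) (desc⇒unique (down-desc a k)) (upTo-unique a k)
    (λ y∈ → ∈-upTo⁺ (proj₁ (∈-down⁻ y∈)) (proj₂ (∈-down⁻ y∈)))
    (λ y∈ → ∈-down⁺ (proj₁ (∈-upTo⁻ y∈)) (proj₂ (∈-upTo⁻ y∈)))

  desc↭upTo⇒down : ∀ {P} a k → Desc P → P ↭ applyUpTo (a +_) k → P ≡ down a k
  desc↭upTo⇒down a k dP p = desc-ext dP (down-desc a k)
    (λ y∈ → ∈-down⁺ (proj₁ (∈-upTo⁻ (∈-resp-↭ p y∈))) (proj₂ (∈-upTo⁻ (∈-resp-↭ p y∈))))
    (λ y∈ → ∈-resp-↭ (↭-sym p) (∈-upTo⁺ (proj₁ (∈-down⁻ y∈)) (proj₂ (∈-down⁻ y∈))))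

module Positions where

  open import Defs using (At)
  open import Data.Nat using (ℕ; zero; suc; _≤_; z≤n; s≤s)
  open import Data.Nat.Properties using (suc-injective; +-comm)
  open import Data.List using (List; []; _∷_; _++_; length; take)
  open import Data.List.Properties using (length-++; ++-assoc; ∷-injectiveʳ)
  open import Data.Product using (∃-syntax; _×_; _,_; proj₁)
  open import Relation.Binary.PropositionalEquality using (_≡_; refl; sym; trans; cong)

  split-unique : ∀ (p₁ p₂ s₁ s₂ : List ℕ) {x y} → p₁ ++ x ∷ s₁ ≡ p₂ ++ y ∷ s₂ →
                 length p₁ ≡ length p₂ → x ≡ y × s₁ ≡ s₂
  split-unique [] [] s₁ s₂ refl _ = refl , refl
  split-unique (_ ∷ p₁) (_ ∷ p₂) s₁ s₂ e l = split-unique p₁ p₂ s₁ s₂ (∷-injectiveʳ e) (suc-injective l)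

  at-unique : ∀ {π i x y} → At π i x → At π i y → x ≡ y
  at-unique (p₁ , s₁ , e₁ , l₁) (p₂ , s₂ , e₂ , l₂) =
    proj₁ (split-unique p₁ p₂ s₁ s₂ (trans (sym e₁) e₂) (suc-injective (trans l₁ (sym l₂))))

  at-positive : ∀ {π i x} → At π i x → 1 ≤ i
  at-positive (_ , _ , _ , refl) = s≤s z≤n

  split-adjacent : ∀ (D : List ℕ) k → suc (suc k) ≤ length D →
    ∃[ D₁ ] ∃[ u ] ∃[ v ] ∃[ D₂ ] (D ≡ D₁ ++ u ∷ v ∷ D₂ × length D₁ ≡ k)
  split-adjacent (u ∷ v ∷ D₂) zero _ = [] , u , v , D₂ , refl , refl
  split-adjacent (x ∷ D) (suc k) (s≤s le) with split-adjacent D k le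
  ... | D₁ , u , v , D₂ , refl , refl = x ∷ D₁ , u , v , D₂ , refl , refl

  take-prefix : ∀ (P : List ℕ) xs → take (length P) (P ++ xs) ≡ P
  take-prefix [] xs = refl
  take-prefix (x ∷ P) xs = cong (x ∷_) (take-prefix P xs)

  at-adjacent : ∀ D₁ u v D₂ rest →
    At ((D₁ ++ u ∷ v ∷ D₂) ++ rest) (suc (length D₁)) u ×
    At ((D₁ ++ u ∷ v ∷ D₂) ++ rest) (suc (suc (length D₁))) v
  at-adjacent D₁ u v D₂ rest =
    (D₁ , v ∷ D₂ ++ rest , ++-assoc D₁ (u ∷ v ∷ D₂) rest , refl) ,
    (D₁ ++ u ∷ [] , D₂ ++ rest ,
       trans (++-assoc D₁ (u ∷ v ∷ D₂) rest) (sym (++-assoc D₁ (u ∷ []) (v ∷ D₂ ++ rest))) ,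
       cong suc (trans (length-++ D₁) (+-comm (length D₁) 1)))

-- The grammar for the tails R.  S and B are the remaining small and big letters,
-- each listed in decreasing order, so their heads are the largest ones.
module Tails where

  open import Data.Nat using (ℕ)
  open import Data.List using (List; []; _∷_; _++_; map)

  consAll : ℕ → List (List ℕ) → List (List ℕ)
  consAll x = map (x ∷_)

  mutual
    tails : List ℕ → List ℕ → List (List ℕ)
    tails S B = tailsEmpty S B ++ (tailsSmall S B ++ (tailsBig S B ++ tailsSecond S B))

    tailsEmpty : List ℕ → List ℕ → List (List ℕ)
    tailsEmpty [] [] = [] ∷ []
    tailsEmpty [] (_ ∷ _) = []
    tailsEmpty (_ ∷ _) _ = []

    tailsSmall : List ℕ → List ℕ → List (List ℕ)
    tailsSmall [] B = []
    tailsSmall (s ∷ S) B = consAll s (tails S B)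

    tailsBig : List ℕ → List ℕ → List (List ℕ)
    tailsBig S [] = []
    tailsBig S (b ∷ B) = consAll b (tails S B)

    tailsSecond : List ℕ → List ℕ → List (List ℕ)
    tailsSecond S [] = []
    tailsSecond S (_ ∷ []) = []
    tailsSecond S (c ∷ r ∷ B) = consAll r (pending S c B)

    -- pending S c B: arrangements of {c} ∪ S ∪ B while c is pending (c above B).
    -- Writing c forces all remaining letters in decreasing order.
    pending : List ℕ → ℕ → List ℕ → List (List ℕ)
    pending S c B = (c ∷ (B ++ S)) ∷ (pendingSmall S c B ++ pendingBig S c B)

    pendingSmall : List ℕ → ℕ → List ℕ → List (List ℕ)
    pendingSmall [] c B = []
    pendingSmall (s ∷ S) c B = consAll s (pending S c B)

    pendingBig : List ℕ → ℕ → List ℕ → List (List ℕ)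
    pendingBig S c [] = []
    pendingBig S c (b ∷ B) = consAll b (pending S c B)

-- The threshold θ separates the small letters and
-- the letters of the initial run (< θ) from n and the big letters (≥ θ).
module TailSoundness (θ : Data.Nat.ℕ) where

  open Subsequences
  open Descending
  open Patterns
  open Tails
  open import Data.Nat using (ℕ; _<_; _≤_; _≤?_)
  open import Data.Nat.Properties using (<-asym; <-irrefl; <-trans; <-≤-trans; ≤-trans; <⇒≤; <⇒≱; ≰⇒>)
  open import Data.List using (List; []; _∷_; _++_)
  open import Data.List.Properties using (++-assoc; ++-identityʳ)
  open import Data.List.Membership.Propositional using (_∈_; _∉_)
  open import Data.List.Membership.Propositional.Properties using (∈-++⁻; map∷⁻)
  open import Data.List.Relation.Unary.Any using (here; there)
  import Data.List.Relation.Unary.AllPairs as AllPairs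
  open import Data.Product using (_×_; _,_; proj₁; proj₂)
  open import Data.Sum using (_⊎_; inj₁; inj₂)
  open import Data.Empty using (⊥-elim)
  open import Relation.Binary.PropositionalEquality using (_≡_; refl; sym; subst)
  open import Relation.Nullary using (yes; no)

  Crossing : List ℕ → Set
  Crossing P = ∀ {p q} → (p ∷ q ∷ []) ⊆ P → p < q → p < θ × θ ≤ q

  CrossingOr : ℕ → List ℕ → Set
  CrossingOr c P = ∀ {p q} → (p ∷ q ∷ []) ⊆ P → p < q → (p < θ × θ ≤ q) ⊎ q ≡ c

  AboveAll : List ℕ → List ℕ → Set
  AboveAll P Ss = ∀ {y s} → y ∈ P → s ∈ Ss → s < y

  HighAbove : List ℕ → List ℕ → Set
  HighAbove P Bs = ∀ {y v} → y ∈ P → θ ≤ y → v ∈ Bs → v < y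

  AfterAbove : ℕ → List ℕ → List ℕ → Set
  AfterAbove c P Bs = ∀ {r} → (c ∷ r ∷ []) ⊆ P → ∀ {v} → v ∈ Bs → v < r

  record Letters (Ss Bs : List ℕ) : Set where
    field
      small-desc : Desc Ss
      big-desc : Desc Bs
      low : ∀ {s} → s ∈ Ss → s < θ
      high : ∀ {b} → b ∈ Bs → θ ≤ b

  letters-small : ∀ {s Ss Bs} → Letters (s ∷ Ss) Bs → Letters Ss Bs
  letters-small L = record
    { small-desc = AllPairs.tail small-desc ; big-desc = big-desc ; low = λ s∈ → low (there s∈) ; high = high }
    where open Letters L

  letters-big : ∀ {Ss b Bs} → Letters Ss (b ∷ Bs) → Letters Ss Bs
  letters-big L = record
    { small-desc = small-desc ; big-desc = AllPairs.tail big-desc ; low = low ; high = λ b∈ → high (there b∈) }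
    where open Letters L

  record Prefix (P Ss Bs : List ℕ) : Set where
    field
      avoids : Av P
      above-smalls : AboveAll P Ss
      crossing : Crossing P
      high-above : HighAbove P Bs

  noBadEnd-below : ∀ {P x} → (∀ {y} → y ∈ P → x < y) → NoBadEnd P x
  noBadEnd-below x< s (inj₁ (_ , _ , r<x)) = <-asym r<x (x< (third s))
  noBadEnd-below x< s (inj₂ (inj₁ (_ , q<x , _))) = <-asym q<x (x< (to∈ (pair₂₃ s)))
  noBadEnd-below x< s (inj₂ (inj₂ (r<x , _ , _))) = <-asym r<x (x< (third s))

  noBadEnd-crossing : ∀ {P x} → Crossing P → θ ≤ x → NoBadEnd P x
  noBadEnd-crossing cr θ≤x s (inj₁ (p<q , q<r , _)) =
    <⇒≱ (proj₁ (cr (pair₂₃ s) q<r)) (proj₂ (cr (pair₁₂ s) p<q))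
  noBadEnd-crossing cr θ≤x s (inj₂ (inj₁ (p<q , q<x , x<r))) =
    <⇒≱ (proj₁ (cr (pair₂₃ s) (<-trans q<x x<r))) (proj₂ (cr (pair₁₂ s) p<q))
  noBadEnd-crossing cr θ≤x s (inj₂ (inj₂ (r<x , x<p , p<q))) =
    <⇒≱ (proj₁ (cr (pair₁₂ s) p<q)) (≤-trans θ≤x (<⇒≤ x<p))

  snoc-++ : ∀ (P : List ℕ) x R → (P ++ x ∷ []) ++ R ≡ P ++ x ∷ R
  snoc-++ P x R = ++-assoc P (x ∷ []) R

  prefix-small : ∀ {P s Ss Bs} → Letters (s ∷ Ss) Bs → Prefix P (s ∷ Ss) Bs → Prefix (P ++ s ∷ []) Ss Bs
  prefix-small {P} L I = record
    { avoids = av-snoc P avoids (noBadEnd-below (λ y∈ → above-smalls y∈ (here refl)))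
    ; above-smalls = above
    ; crossing = cross
    ; high-above = highA
    }
    where
    open Letters L
    open Prefix I
    above : AboveAll (P ++ _ ∷ []) _
    above y∈ s∈ with snoc-mem P y∈
    ... | inj₁ y∈P = above-smalls y∈P (there s∈)
    ... | inj₂ refl = desc-head small-desc s∈
    cross : Crossing (P ++ _ ∷ [])
    cross s p<q with snoc-pair P s
    ... | inj₁ t = crossing t p<q
    ... | inj₂ (refl , p∈) = ⊥-elim (<-asym p<q (above-smalls p∈ (here refl)))
    highA : HighAbove (P ++ _ ∷ []) _
    highA y∈ θ≤y b∈ with snoc-mem P y∈
    ... | inj₁ y∈P = high-above y∈P θ≤y b∈
    ... | inj₂ refl = ⊥-elim (<⇒≱ (low (here refl)) θ≤y)

  prefix-big : ∀ {P Ss Bs Bs' b} → Letters Ss Bs → b ∈ Bs → (∀ {v} → v ∈ Bs' → v < b) →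
    (∀ {v} → v ∈ Bs' → v ∈ Bs) → Prefix P Ss Bs → Prefix (P ++ b ∷ []) Ss Bs'
  prefix-big {P} L b∈ below sub I = record
    { avoids = av-snoc P avoids (noBadEnd-crossing crossing (high b∈))
    ; above-smalls = above
    ; crossing = cross
    ; high-above = highA
    }
    where
    open Letters L
    open Prefix I
    above : AboveAll (P ++ _ ∷ []) _
    above y∈ s∈ with snoc-mem P y∈
    ... | inj₁ y∈P = above-smalls y∈P s∈
    ... | inj₂ refl = <-≤-trans (low s∈) (high b∈)
    cross : Crossing (P ++ _ ∷ [])
    cross s p<q with snoc-pair P s
    ... | inj₁ t = crossing t p<q
    ... | inj₂ (refl , p∈) with θ ≤? _
    ... | yes θ≤p = ⊥-elim (<-asym p<q (high-above p∈ θ≤p b∈))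
    ... | no θ≰p = ≰⇒> θ≰p , high b∈
    highA : HighAbove (P ++ _ ∷ []) _
    highA y∈ θ≤y v∈ with snoc-mem P y∈
    ... | inj₁ y∈P = high-above y∈P θ≤y (sub v∈)
    ... | inj₂ refl = below v∈

  -- Once the pending letter c is written, the rest is forced to be Bs ++ Ss.
  record Forced (c : ℕ) (P Ss Bs : List ℕ) : Set where
    field
      avoids : Av P
      above-smalls : AboveAll P Ss
      crossing-or : CrossingOr c P
      high-above : HighAbove P Bs
      after-above : AfterAbove c P Bs

  noBadEnd-forced : ∀ {P Ss Bs x c} → Forced c P Ss Bs → θ ≤ x → x < c → x ∈ Bs → NoBadEnd P x
  noBadEnd-forced F θ≤x x<c x∈ s (inj₁ (p<q , q<r , r<x)) with Forced.crossing-or F (pair₁₂ s) p<q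
  ... | inj₂ refl = <-asym x<c (<-trans q<r r<x)
  ... | inj₁ (_ , θ≤q) with Forced.crossing-or F (pair₂₃ s) q<r
  ... | inj₁ (q<θ , _) = <⇒≱ q<θ θ≤q
  ... | inj₂ refl = <-asym x<c r<x
  noBadEnd-forced F θ≤x x<c x∈ s (inj₂ (inj₁ (p<q , q<x , x<r))) with Forced.crossing-or F (pair₁₂ s) p<q
  ... | inj₂ refl = <-asym x<c q<x
  ... | inj₁ (_ , θ≤q) with Forced.crossing-or F (pair₂₃ s) (<-trans q<x x<r)
  ... | inj₁ (q<θ , _) = <⇒≱ q<θ θ≤q
  ... | inj₂ refl = <-asym q<x (Forced.high-above F (to∈ (pair₂₃ s)) θ≤q x∈)
  noBadEnd-forced F θ≤x x<c x∈ s (inj₂ (inj₂ (r<x , x<p , p<q))) with Forced.crossing-or F (pair₁₂ s) p<q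
  ... | inj₁ (p<θ , _) = <⇒≱ p<θ (≤-trans θ≤x (<⇒≤ x<p))
  ... | inj₂ refl = <-asym r<x (Forced.after-above F (pair₂₃ s) x∈)

  av-smalls : ∀ Ss P → Desc Ss → Av P → AboveAll P Ss → Av (P ++ Ss)
  av-smalls [] P d av above = subst Av (sym (++-identityʳ P)) av
  av-smalls (s ∷ Ss) P d av above =
    subst Av (snoc-++ P s Ss) (av-smalls Ss (P ++ s ∷ []) (AllPairs.tail d)
      (av-snoc P av (noBadEnd-below (λ y∈ → above y∈ (here refl)))) above')
    where
    above' : AboveAll (P ++ s ∷ []) Ss
    above' y∈ s∈ with snoc-mem P y∈
    ... | inj₁ y∈P = above y∈P (there s∈)
    ... | inj₂ refl = desc-head d s∈

  av-forced : ∀ c Bs Ss P → Letters Ss Bs → (∀ {v} → v ∈ Bs → v < c) → Forced c P Ss Bs → Av (P ++ (Bs ++ Ss))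
  av-forced c [] Ss P L _ F = av-smalls Ss P (Letters.small-desc L) (Forced.avoids F) (Forced.above-smalls F)
  av-forced c (b ∷ Bs) Ss P L below-c F =
    subst Av (snoc-++ P b (Bs ++ Ss)) (av-forced c Bs Ss (P ++ b ∷ []) (letters-big L) (λ v∈ → below-c (there v∈)) F')
    where
    open Letters L
    open Forced F
    F' : Forced c (P ++ b ∷ []) Ss Bs
    F' = record
      { avoids = av-snoc P avoids (noBadEnd-forced F (high (here refl)) (below-c (here refl)) (here refl))
      ; above-smalls = above
      ; crossing-or = cross
      ; high-above = highA
      ; after-above = after
      }
      where
      above : AboveAll (P ++ b ∷ []) Ss
      above y∈ s∈ with snoc-mem P y∈
      ... | inj₁ y∈P = above-smalls y∈P s∈
      ... | inj₂ refl = <-≤-trans (low s∈) (high (here refl))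
      cross : CrossingOr c (P ++ b ∷ [])
      cross s p<q with snoc-pair P s
      ... | inj₁ t = crossing-or t p<q
      ... | inj₂ (refl , p∈) with θ ≤? _
      ... | yes θ≤p = ⊥-elim (<-asym p<q (high-above p∈ θ≤p (here refl)))
      ... | no θ≰p = inj₁ (≰⇒> θ≰p , high (here refl))
      highA : HighAbove (P ++ b ∷ []) Bs
      highA y∈ θ≤y v∈ with snoc-mem P y∈
      ... | inj₁ y∈P = high-above y∈P θ≤y (there v∈)
      ... | inj₂ refl = desc-head big-desc v∈
      after : AfterAbove c (P ++ b ∷ []) Bs
      after s v∈ with snoc-pair P s
      ... | inj₁ t = after-above t (there v∈)
      ... | inj₂ (refl , _) = desc-head big-desc v∈

  forced-start : ∀ {c P Ss Bs} → Letters Ss Bs → θ ≤ c → (∀ {v} → v ∈ Bs → v < c) → c ∉ P →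
    Prefix P Ss Bs → Forced c (P ++ c ∷ []) Ss Bs
  forced-start {c} {P} L θ≤c below-c c∉ I = record
    { avoids = av-snoc P avoids (noBadEnd-crossing crossing θ≤c)
    ; above-smalls = above
    ; crossing-or = cross
    ; high-above = highA
    ; after-above = after
    }
    where
    open Letters L
    open Prefix I
    above : AboveAll (P ++ c ∷ []) _
    above y∈ s∈ with snoc-mem P y∈
    ... | inj₁ y∈P = above-smalls y∈P s∈
    ... | inj₂ refl = <-≤-trans (low s∈) θ≤c
    cross : CrossingOr c (P ++ c ∷ [])
    cross s p<q with snoc-pair P s
    ... | inj₁ t = inj₁ (crossing t p<q)
    ... | inj₂ (refl , _) = inj₂ refl
    highA : HighAbove (P ++ c ∷ []) _
    highA y∈ θ≤y v∈ with snoc-mem P y∈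
    ... | inj₁ y∈P = high-above y∈P θ≤y v∈
    ... | inj₂ refl = below-c v∈
    after : AfterAbove c (P ++ c ∷ []) _
    after s v∈ with snoc-pair P s
    ... | inj₁ t = ⊥-elim (c∉ (to∈ t))
    ... | inj₂ (refl , c∈) = ⊥-elim (c∉ c∈)

  ∉-snoc : ∀ {P : List ℕ} {c x} → c ∉ P → x < c → c ∉ (P ++ x ∷ [])
  ∉-snoc {P} c∉ x<c c∈ with snoc-mem P c∈
  ... | inj₁ c∈P = c∉ c∈P
  ... | inj₂ refl = <-irrefl refl x<c

  av-pending : ∀ Ss c Bs P R → R ∈ pending Ss c Bs → Letters Ss Bs → θ ≤ c →
    (∀ {v} → v ∈ Bs → v < c) → c ∉ P → Prefix P Ss Bs → Av (P ++ R)
  av-pending Ss c Bs P R (here refl) L θ≤c below-c c∉ I =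
    subst Av (snoc-++ P c (Bs ++ Ss)) (av-forced c Bs Ss (P ++ c ∷ []) L below-c (forced-start L θ≤c below-c c∉ I))
  av-pending Ss c Bs P R (there R∈) L θ≤c below-c c∉ I with ∈-++⁻ (pendingSmall Ss c Bs) R∈
  av-pending (s ∷ Ss) c Bs P R (there R∈) L θ≤c below-c c∉ I | inj₁ R∈' with map∷⁻ R∈'
  ... | R' , R'∈ , refl =
    subst Av (snoc-++ P s R') (av-pending Ss c Bs (P ++ s ∷ []) R' R'∈ (letters-small L) θ≤c below-c
      (∉-snoc c∉ (<-≤-trans (Letters.low L (here refl)) θ≤c)) (prefix-small L I))
  av-pending Ss c (b ∷ Bs) P R (there R∈) L θ≤c below-c c∉ I | inj₂ R∈' with map∷⁻ R∈'
  ... | R' , R'∈ , refl =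
    subst Av (snoc-++ P b R') (av-pending Ss c Bs (P ++ b ∷ []) R' R'∈ (letters-big L) θ≤c (λ v∈ → below-c (there v∈))
      (∉-snoc c∉ (below-c (here refl))) (prefix-big L (here refl) (desc-head (Letters.big-desc L)) there I))

  av-tails : ∀ Ss Bs P R → R ∈ tails Ss Bs → Letters Ss Bs → Prefix P Ss Bs → Av (P ++ R)
  av-tails Ss Bs P R R∈ L I with ∈-++⁻ (tailsEmpty Ss Bs) R∈
  av-tails [] [] P R R∈ L I | inj₁ (here refl) = subst Av (sym (++-identityʳ P)) (Prefix.avoids I)
  av-tails Ss Bs P R R∈ L I | inj₂ R∈₁ with ∈-++⁻ (tailsSmall Ss Bs) R∈₁
  av-tails (s ∷ Ss) Bs P R R∈ L I | inj₂ R∈₁ | inj₁ R∈₂ with map∷⁻ R∈₂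
  ... | R' , R'∈ , refl =
    subst Av (snoc-++ P s R') (av-tails Ss Bs (P ++ s ∷ []) R' R'∈ (letters-small L) (prefix-small L I))
  av-tails Ss Bs P R R∈ L I | inj₂ R∈₁ | inj₂ R∈₂ with ∈-++⁻ (tailsBig Ss Bs) R∈₂
  av-tails Ss (b ∷ Bs) P R R∈ L I | inj₂ R∈₁ | inj₂ R∈₂ | inj₁ R∈₃ with map∷⁻ R∈₃
  ... | R' , R'∈ , refl =
    subst Av (snoc-++ P b R') (av-tails Ss Bs (P ++ b ∷ []) R' R'∈ (letters-big L)
      (prefix-big L (here refl) (desc-head (Letters.big-desc L)) there I))
  av-tails Ss (c ∷ r ∷ Bs) P R R∈ L I | inj₂ R∈₁ | inj₂ R∈₂ | inj₂ R∈₃ with map∷⁻ R∈₃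
  ... | R' , R'∈ , refl =
    subst Av (snoc-++ P r R') (av-pending Ss c Bs (P ++ r ∷ []) R' R'∈ (letters-big (letters-big L))
      (high (here refl)) (λ v∈ → <-trans (r> v∈) c>r) c∉
      (prefix-big L (there (here refl)) r> (λ v∈ → there (there v∈)) I))
    where
    open Letters L
    r> : ∀ {v} → v ∈ Bs → v < r
    r> = desc-head (AllPairs.tail big-desc)
    c>r : r < c
    c>r = desc-head big-desc (here refl)
    c∉ : c ∉ (P ++ r ∷ [])
    c∉ c∈ with snoc-mem P c∈
    ... | inj₁ c∈P = <-irrefl refl (Prefix.high-above I c∈P (high (here refl)) (here refl))
    ... | inj₂ e = <-irrefl (sym e) c>r

-- The tail R follows a prefix P containing the
-- first letter m, then n, and the last letter a of the initial run; R is a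
-- rearrangement of Bs ++ Ss (big letters above m, small ones below a) and
-- P ++ R avoids T.  Then R is produced by the grammar: at each step, any other
-- choice of next letter creates a forbidden shape.
module TailCompleteness (m n a : Data.Nat.ℕ) (m<n : Data.Nat._<_ m n) where

  open Subsequences
  open Descending
  open Patterns
  open Tails
  open import Data.Nat using (ℕ; _<_)
  open import Data.Nat.Properties using (<-irrefl; <-trans)
  open import Data.List using (List; []; _∷_; _++_)
  open import Data.List.Properties using (++-assoc)
  open import Data.List.Membership.Propositional using (_∈_)
  open import Data.List.Membership.Propositional.Properties using (∈-++⁻; ∈-++⁺ˡ; ∈-++⁺ʳ; ∈-map⁺)
  open import Data.List.Relation.Unary.Any using (here; there)
  import Data.List.Relation.Unary.AllPairs as AllPairs
  open import Data.List.Relation.Binary.Permutation.Propositional using (_↭_; ↭-sym)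
  open import Data.List.Relation.Binary.Permutation.Propositional.Properties using (∈-resp-↭; drop-mid; drop-∷)
  open import Data.Product using (_,_)
  open import Data.Sum using (inj₁; inj₂)
  open import Data.Empty using (⊥; ⊥-elim)
  open import Relation.Binary.PropositionalEquality using (_≡_; _≢_; refl; sym; cong; subst)
  open import Function using (_∘′_)
  open Intervals using (unique-resp-↭)

  record Context (P Ss Bs : List ℕ) : Set where
    field
      small-desc : Desc Ss
      big-desc : Desc Bs
      small<m : ∀ {s} → s ∈ Ss → s < m
      a<big : ∀ {b} → b ∈ Bs → a < b
      small<big : ∀ {s b} → s ∈ Ss → b ∈ Bs → s < b
      m-then-n : (m ∷ n ∷ []) ⊆ P
      a∈P : a ∈ P

  context-snoc : ∀ {P Ss Bs x} → Context P Ss Bs → Context (P ++ x ∷ []) Ss Bs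
  context-snoc C = record
    { small-desc = small-desc ; big-desc = big-desc
    ; small<m = small<m ; a<big = a<big ; small<big = small<big
    ; m-then-n = ++⁺ʳ _ m-then-n ; a∈P = ∈-++⁺ˡ a∈P }
    where open Context C

  drop-small : ∀ {P s Ss Bs} → Context P (s ∷ Ss) Bs → Context P Ss Bs
  drop-small C = record
    { small-desc = AllPairs.tail small-desc ; big-desc = big-desc
    ; small<m = λ s∈ → small<m (there s∈) ; a<big = a<big
    ; small<big = λ s∈ → small<big (there s∈)
    ; m-then-n = m-then-n ; a∈P = a∈P }
    where open Context C

  drop-big : ∀ {P Ss b Bs} → Context P Ss (b ∷ Bs) → Context P Ss Bs
  drop-big C = record
    { small-desc = small-desc ; big-desc = AllPairs.tail big-desc
    ; small<m = small<m ; a<big = λ b∈ → a<big (there b∈)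
    ; small<big = λ s∈ b∈ → small<big s∈ (there b∈)
    ; m-then-n = m-then-n ; a∈P = a∈P }
    where open Context C

  -- The two ways a wrong choice fails.  A small letter x written before a larger
  -- small letter y gives m n x y ≅ 3412.
  small-before-larger : ∀ {P x R y} → Av (P ++ x ∷ R) → (m ∷ n ∷ []) ⊆ P →
    x < y → y < m → y ∈ R → ⊥
  small-before-larger av m-n x<y y<m y∈ = av (++⁺ m-n (refl ∷ from∈ y∈)) (inj₂ (inj₂ (x<y , y<m , m<n)))

  -- A letter x above a, followed later by two larger letters y < z, gives
  -- a x y z ≅ 1234 or a x z y ≅ 1243.
  two-larger-after : ∀ {P x R y z} → Av (P ++ x ∷ R) → a ∈ P → a < x → x < y → y < z →
    y ∈ R → z ∈ R → ⊥
  two-larger-after av a∈ a<x x<y y<z y∈ z∈ with order y∈ z∈ (λ e → <-irrefl e y<z)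
  ... | inj₁ s = av (++⁺ (from∈ a∈) (refl ∷ s)) (inj₁ (a<x , x<y , y<z))
  ... | inj₂ s = av (++⁺ (from∈ a∈) (refl ∷ s)) (inj₂ (inj₁ (a<x , x<y , y<z)))

  av-shift : ∀ {P x R} → Av (P ++ x ∷ R) → Av ((P ++ x ∷ []) ++ R)
  av-shift {P} {x} {R} = subst Av (sym (++-assoc P (x ∷ []) R))

  in-rest : ∀ {x y : ℕ} {R L} → x ∷ R ↭ L → y ∈ L → y ≢ x → y ∈ R
  in-rest p y∈ y≢x with ∈-resp-↭ (↭-sym p) y∈
  ... | here e = ⊥-elim (y≢x e)
  ... | there y∈R = y∈R

  consAll⁺ : ∀ {x L Ls} → L ∈ Ls → (x ∷ L) ∈ consAll x Ls
  consAll⁺ {x} = ∈-map⁺ (x ∷_)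

  ∈-tailsSmall : ∀ {Ss Bs L} → L ∈ tailsSmall Ss Bs → L ∈ tails Ss Bs
  ∈-tailsSmall {Ss} {Bs} = ∈-++⁺ʳ (tailsEmpty Ss Bs) ∘′ ∈-++⁺ˡ

  ∈-tailsBig : ∀ {Ss Bs L} → L ∈ tailsBig Ss Bs → L ∈ tails Ss Bs
  ∈-tailsBig {Ss} {Bs} = ∈-++⁺ʳ (tailsEmpty Ss Bs) ∘′ ∈-++⁺ʳ (tailsSmall Ss Bs) ∘′ ∈-++⁺ˡ

  ∈-tailsSecond : ∀ {Ss Bs L} → L ∈ tailsSecond Ss Bs → L ∈ tails Ss Bs
  ∈-tailsSecond {Ss} {Bs} = ∈-++⁺ʳ (tailsEmpty Ss Bs) ∘′ ∈-++⁺ʳ (tailsSmall Ss Bs) ∘′ ∈-++⁺ʳ (tailsBig Ss Bs)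

  record Pending (P Ss : List ℕ) (c : ℕ) (Bs : List ℕ) : Set where
    field
      context : Context P Ss Bs
      r : ℕ
      r∈P : r ∈ P
      big<r : ∀ {b} → b ∈ Bs → b < r
      small<r : ∀ {s} → s ∈ Ss → s < r
      r<c : r < c

  pending-start : ∀ {P Ss c r Bs} → Context P Ss (c ∷ r ∷ Bs) → Pending (P ++ r ∷ []) Ss c Bs
  pending-start {P} C = record
    { context = context-snoc (drop-big (drop-big C))
    ; r = _ ; r∈P = ∈-++⁺ʳ P (here refl)
    ; big<r = desc-head (AllPairs.tail big-desc)
    ; small<r = λ s∈ → small<big s∈ (there (here refl))
    ; r<c = desc-head big-desc (here refl) }
    where open Context C

  pending-small : ∀ {P s Ss c Bs} → Pending P (s ∷ Ss) c Bs → Pending (P ++ s ∷ []) Ss c Bs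
  pending-small K = record
    { context = context-snoc (drop-small context) ; r = r ; r∈P = ∈-++⁺ˡ r∈P
    ; big<r = big<r ; small<r = λ s∈ → small<r (there s∈) ; r<c = r<c }
    where open Pending K

  pending-big : ∀ {P Ss c b Bs} → Pending P Ss c (b ∷ Bs) → Pending (P ++ b ∷ []) Ss c Bs
  pending-big K = record
    { context = context-snoc (drop-big context) ; r = r ; r∈P = ∈-++⁺ˡ r∈P
    ; big<r = λ b∈ → big<r (there b∈) ; small<r = small<r ; r<c = r<c }
    where open Pending K

  -- Once c is written the rest is decreasing (an ascent p < q after r c would
  -- form 3412), hence it is Bs ++ Ss.
  forced-after-pending : ∀ {P Ss c Bs R} → Pending P Ss c Bs → Av (P ++ c ∷ R) → R ↭ Bs ++ Ss → R ≡ Bs ++ Ss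
  forced-after-pending {P} {Ss} {c} {Bs} {R} K av p =
    desc-ext desc-R desc-rest (∈-resp-↭ p) (∈-resp-↭ (↭-sym p))
    where
    open Pending K
    open Context context
    desc-rest : Desc (Bs ++ Ss)
    desc-rest = desc-++ big-desc small-desc (λ b∈ s∈ → small<big s∈ b∈)
    below-r : ∀ {y} → y ∈ R → y < r
    below-r y∈ with ∈-++⁻ Bs (∈-resp-↭ p y∈)
    ... | inj₁ b∈ = big<r b∈
    ... | inj₂ s∈ = small<r s∈
    desc-R : Desc R
    desc-R = desc-from-pairs (unique-resp-↭ (↭-sym p) (desc⇒unique desc-rest))
      (λ s p<q → av (++⁺ (from∈ r∈P) (refl ∷ s)) (inj₂ (inj₂ (p<q , below-r (to∈ (⊆-trans (_ ∷ʳ refl ∷ []) s)) , r<c))))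

  complete-pending : ∀ Ss c Bs P R → Pending P Ss c Bs → Av (P ++ R) → R ↭ c ∷ (Bs ++ Ss) →
    R ∈ pending Ss c Bs
  complete-pending Ss c Bs P [] K av p with ∈-resp-↭ (↭-sym p) (here refl)
  ... | ()
  complete-pending Ss c Bs P (x ∷ R) K av p with ∈-resp-↭ p (here refl)
  ... | here refl = here (cong (c ∷_) (forced-after-pending K av (drop-∷ p)))
  ... | there x∈ with ∈-++⁻ Bs x∈
  complete-pending (s ∷ Ss) c Bs P (x ∷ R) K av p | there _ | inj₂ (here refl) =
    there (∈-++⁺ˡ (consAll⁺ (complete-pending Ss c Bs (P ++ x ∷ []) R (pending-small K) (av-shift {P} av)
      (drop-mid [] (c ∷ Bs) p))))
  complete-pending (s ∷ Ss) c Bs P (x ∷ R) K av p | there _ | inj₂ (there x∈) =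
    ⊥-elim (small-before-larger av m-then-n x<s (small<m (here refl))
      (in-rest p (there (∈-++⁺ʳ Bs (here refl))) (λ e → <-irrefl (sym e) x<s)))
    where
    open Context (Pending.context K)
    x<s = desc-head small-desc x∈
  complete-pending Ss c (h ∷ Bs) P (x ∷ R) K av p | there _ | inj₁ (here refl) =
    there (∈-++⁺ʳ (pendingSmall Ss c (x ∷ Bs))
      (consAll⁺ (complete-pending Ss c Bs (P ++ x ∷ []) R (pending-big K) (av-shift {P} av) (drop-mid [] (c ∷ []) p))))
  complete-pending Ss c (h ∷ Bs) P (x ∷ R) K av p | there _ | inj₁ (there x∈) =
    ⊥-elim (two-larger-after av a∈P (a<big (there x∈)) x<h h<c
      (in-rest p (there (here refl)) (λ e → <-irrefl (sym e) x<h))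
      (in-rest p (here refl) (λ e → <-irrefl (sym e) (<-trans x<h h<c))))
    where
    open Pending K
    open Context context
    x<h = desc-head big-desc x∈
    h<c = <-trans (big<r (here refl)) r<c

  complete-tails : ∀ Ss Bs P R → Context P Ss Bs → Av (P ++ R) → R ↭ Bs ++ Ss → R ∈ tails Ss Bs
  complete-tails [] [] P [] C av p = here refl
  complete-tails (s ∷ Ss) Bs P [] C av p with ∈-resp-↭ (↭-sym p) (∈-++⁺ʳ Bs (here refl))
  ... | ()
  complete-tails [] (b ∷ Bs) P [] C av p with ∈-resp-↭ (↭-sym p) (here refl)
  ... | ()
  complete-tails Ss Bs P (x ∷ R) C av p with ∈-++⁻ Bs (∈-resp-↭ p (here refl))
  complete-tails (s ∷ Ss) Bs P (x ∷ R) C av p | inj₂ (here refl) =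
    ∈-tailsSmall {x ∷ Ss} {Bs} (consAll⁺ (complete-tails Ss Bs (P ++ x ∷ []) R (context-snoc (drop-small C)) (av-shift {P} av)
      (drop-mid [] Bs p)))
  complete-tails (s ∷ Ss) Bs P (x ∷ R) C av p | inj₂ (there x∈) =
    ⊥-elim (small-before-larger av m-then-n x<s (small<m (here refl))
      (in-rest p (∈-++⁺ʳ Bs (here refl)) (λ e → <-irrefl (sym e) x<s)))
    where
    open Context C
    x<s = desc-head small-desc x∈
  complete-tails Ss (b ∷ Bs) P (x ∷ R) C av p | inj₁ (here refl) =
    ∈-tailsBig {Ss} {x ∷ Bs} (consAll⁺ (complete-tails Ss Bs (P ++ x ∷ []) R (context-snoc (drop-big C)) (av-shift {P} av)
      (drop-∷ p)))
  complete-tails Ss (c ∷ b ∷ Bs) P (x ∷ R) C av p | inj₁ (there (here refl)) =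
    ∈-tailsSecond {Ss} {c ∷ x ∷ Bs} (consAll⁺ (complete-pending Ss c Bs (P ++ x ∷ []) R (pending-start C)
      (av-shift {P} av) (drop-mid [] (c ∷ []) p)))
  complete-tails Ss (c ∷ b ∷ Bs) P (x ∷ R) C av p | inj₁ (there (there x∈)) =
    ⊥-elim (two-larger-after av a∈P (a<big (there (there x∈))) x<b b<c
      (in-rest p (there (here refl)) (λ e → <-irrefl (sym e) x<b))
      (in-rest p (here refl) (λ e → <-irrefl (sym e) (<-trans x<b b<c))))
    where
    open Context C
    x<b = desc-head (AllPairs.tail big-desc) x∈
    b<c = desc-head big-desc (here refl)

-- The grammar never produces a tail twice: different branches start with
-- different letters.
module TailsDistinct where

  open Descending
  open Tails
  open import Data.Nat using (ℕ; _<_)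
  open import Data.Nat.Properties using (<-irrefl; <-trans; <⇒≢)
  open import Data.List using (List; []; _∷_; _++_)
  open import Data.List.Membership.Propositional using (_∈_)
  open import Data.List.Membership.Propositional.Properties using (∈-++⁻; map∷⁻)
  open import Data.List.Relation.Unary.Any using (here; there)
  import Data.List.Relation.Unary.All as All
  import Data.List.Relation.Unary.AllPairs as AllPairs
  open import Data.List.Relation.Unary.AllPairs using ([]; _∷_)
  open import Data.List.Relation.Unary.Unique.Propositional using (Unique)
  open import Data.List.Relation.Unary.Unique.Propositional.Properties using (++⁺; map⁺)
  open import Data.List.Relation.Binary.Disjoint.Propositional using (Disjoint)
  open import Data.List.Properties using (∷-injectiveʳ)
  open import Data.Product using (∃-syntax; _×_; _,_)
  open import Data.Sum using (inj₁; inj₂)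
  open import Relation.Binary.PropositionalEquality using (_≡_; _≢_; refl; sym)
  open import Function using (_∘_)

  unique-consAll : ∀ {x} {Ls : List (List ℕ)} → Unique Ls → Unique (consAll x Ls)
  unique-consAll = map⁺ ∷-injectiveʳ

  disjoint-consAll : ∀ {x y} {Ls Ms : List (List ℕ)} → x ≢ y → Disjoint (consAll x Ls) (consAll y Ms)
  disjoint-consAll x≢y (R∈ , R∈') with map∷⁻ R∈ | map∷⁻ R∈'
  ... | _ , _ , refl | _ , _ , refl = x≢y refl

  disjoint-[]ˡ : ∀ {Ls : List (List ℕ)} → Disjoint [] Ls
  disjoint-[]ˡ (() , _)

  disjoint-[]ʳ : ∀ {Ls : List (List ℕ)} → Disjoint Ls []
  disjoint-[]ʳ (_ , ())

  disjoint-++ : ∀ {A B C : List (List ℕ)} → Disjoint A B → Disjoint A C → Disjoint A (B ++ C)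
  disjoint-++ {B = B} dAB dAC (R∈A , R∈) with ∈-++⁻ B R∈
  ... | inj₁ R∈B = dAB (R∈A , R∈B)
  ... | inj₂ R∈C = dAC (R∈A , R∈C)

  unique-blocks : ∀ {A B C D : List (List ℕ)} → Unique A → Unique B → Unique C → Unique D →
    Disjoint A B → Disjoint A C → Disjoint A D → Disjoint B C → Disjoint B D → Disjoint C D →
    Unique (A ++ (B ++ (C ++ D)))
  unique-blocks uA uB uC uD dAB dAC dAD dBC dBD dCD =
    ++⁺ uA (++⁺ uB (++⁺ uC uD dCD) (disjoint-++ dBC dBD)) (disjoint-++ dAB (disjoint-++ dAC dAD))

  SmallBelowBig : List ℕ → List ℕ → Set
  SmallBelowBig Ss Bs = ∀ {s b} → s ∈ Ss → b ∈ Bs → s < b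

  mutual
    unique-tails : ∀ Ss Bs → Desc Bs → SmallBelowBig Ss Bs → Unique (tails Ss Bs)
    unique-tails [] [] _ _ = All.[] ∷ []
    unique-tails [] (b ∷ []) _ _ =
      unique-blocks {A = []} {B = []} [] [] (unique-consAll (unique-tails [] [] [] (λ ()))) []
        disjoint-[]ˡ disjoint-[]ˡ disjoint-[]ˡ disjoint-[]ˡ disjoint-[]ˡ disjoint-[]ʳ
    unique-tails [] (c ∷ r ∷ Bs) dB _ =
      unique-blocks {A = []} {B = []} [] []
        (unique-consAll (unique-tails [] (r ∷ Bs) (AllPairs.tail dB) (λ ())))
        (unique-consAll (unique-pending [] c Bs (λ ()) (λ ()) (λ b∈ → <-trans (desc-head (AllPairs.tail dB) b∈) r<c)))
        disjoint-[]ˡ disjoint-[]ˡ disjoint-[]ˡ disjoint-[]ˡ disjoint-[]ˡ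
        (disjoint-consAll (<⇒≢ r<c ∘ sym))
      where r<c = desc-head dB (here refl)
    unique-tails (s ∷ Ss) [] dB _ =
      unique-blocks {A = []} [] (unique-consAll (unique-tails Ss [] dB (λ _ ()))) [] []
        disjoint-[]ˡ disjoint-[]ˡ disjoint-[]ˡ disjoint-[]ʳ disjoint-[]ʳ disjoint-[]ˡ
    unique-tails (s ∷ Ss) (b ∷ []) dB s<b =
      unique-blocks {A = []} []
        (unique-consAll (unique-tails Ss (b ∷ []) dB (λ s∈ → s<b (there s∈))))
        (unique-consAll (unique-tails (s ∷ Ss) [] [] (λ _ ()))) []
        disjoint-[]ˡ disjoint-[]ˡ disjoint-[]ˡ (disjoint-consAll (<⇒≢ (s<b (here refl) (here refl))))
        disjoint-[]ʳ disjoint-[]ʳ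
    unique-tails (s ∷ Ss) (c ∷ r ∷ Bs) dB s<b =
      unique-blocks {A = []} []
        (unique-consAll (unique-tails Ss (c ∷ r ∷ Bs) dB (λ s∈ → s<b (there s∈))))
        (unique-consAll (unique-tails (s ∷ Ss) (r ∷ Bs) (AllPairs.tail dB) (λ s∈ b∈ → s<b s∈ (there b∈))))
        (unique-consAll (unique-pending (s ∷ Ss) c Bs (λ s∈ b∈ → s<b s∈ (there (there b∈)))
          (λ s∈ → s<b s∈ (here refl)) (λ b∈ → <-trans (desc-head (AllPairs.tail dB) b∈) r<c)))
        disjoint-[]ˡ disjoint-[]ˡ disjoint-[]ˡ
        (disjoint-consAll (<⇒≢ (s<b (here refl) (here refl))))
        (disjoint-consAll (<⇒≢ (s<b (here refl) (there (here refl)))))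
        (disjoint-consAll (<⇒≢ r<c ∘ sym))
      where r<c = desc-head dB (here refl)

    unique-pending : ∀ Ss c Bs → SmallBelowBig Ss Bs → (∀ {s} → s ∈ Ss → s < c) →
      (∀ {b} → b ∈ Bs → b < c) → Unique (pending Ss c Bs)
    unique-pending Ss c Bs s<b s<c b<c =
      All.tabulate forced-first ∷ ++⁺ (unique-small Ss s<b s<c) (unique-big Bs s<b b<c) (small-big Ss Bs s<b)
      where
      -- Every other branch starts with a letter below c.
      head-small : ∀ Ss {R} → R ∈ pendingSmall Ss c Bs → ∃[ x ] ∃[ R' ] (R ≡ x ∷ R' × x ∈ Ss)
      head-small (s ∷ Ss) R∈ with map∷⁻ R∈
      ... | R' , _ , e = s , R' , e , here refl
      head-big : ∀ Bs {R} → R ∈ pendingBig Ss c Bs → ∃[ x ] ∃[ R' ] (R ≡ x ∷ R' × x ∈ Bs)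
      head-big (b ∷ Bs) R∈ with map∷⁻ R∈
      ... | R' , _ , e = b , R' , e , here refl
      forced-first : ∀ {R} → R ∈ pendingSmall Ss c Bs ++ pendingBig Ss c Bs → (c ∷ (Bs ++ Ss)) ≢ R
      forced-first R∈ e with ∈-++⁻ (pendingSmall Ss c Bs) R∈
      forced-first R∈ e | inj₁ R∈S with head-small Ss R∈S
      ... | x , _ , refl , x∈ with e
      ... | refl = <-irrefl refl (s<c x∈)
      forced-first R∈ e | inj₂ R∈B with head-big Bs R∈B
      ... | x , _ , refl , x∈ with e
      ... | refl = <-irrefl refl (b<c x∈)
      unique-small : ∀ Ss → SmallBelowBig Ss Bs → (∀ {s} → s ∈ Ss → s < c) → Unique (pendingSmall Ss c Bs)
      unique-small [] _ _ = []
      unique-small (s ∷ Ss) s<b s<c =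
        unique-consAll (unique-pending Ss c Bs (λ s∈ → s<b (there s∈)) (λ s∈ → s<c (there s∈)) b<c)
      unique-big : ∀ Bs → SmallBelowBig Ss Bs → (∀ {b} → b ∈ Bs → b < c) → Unique (pendingBig Ss c Bs)
      unique-big [] _ _ = []
      unique-big (b ∷ Bs) s<b b<c =
        unique-consAll (unique-pending Ss c Bs (λ s∈ b∈ → s<b s∈ (there b∈)) s<c (λ b∈ → b<c (there b∈)))
      small-big : ∀ Ss Bs → SmallBelowBig Ss Bs → Disjoint (pendingSmall Ss c Bs) (pendingBig Ss c Bs)
      small-big [] Bs _ = disjoint-[]ˡ
      small-big (s ∷ Ss) [] _ = disjoint-[]ʳ
      small-big (s ∷ Ss) (b ∷ Bs) s<b = disjoint-consAll (<⇒≢ (s<b (here refl) (here refl)))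

-- The explicit list of all counted permutations, in terms of a = s + 1 (last
-- letter of the initial run) and its length j + 1, so that the first letter is
-- m = s + j + 1.  The small letters are down 1 s = s, …, 1 and the big ones are
-- bigs n m = n − 1, …, m + 1.
module CountedList where

  open Tails
  open Intervals
  open TailsDistinct
  open import Data.Nat using (ℕ; zero; suc; _+_; _∸_; _<_; _≤_; _≟_; s≤s)
  open import Data.Nat.Properties
  open import Data.List using (List; []; _∷_; _++_)
  open import Data.List.Membership.Propositional using (_∈_)
  open import Data.List.Membership.Propositional.Properties using (∈-++⁻; ∈-++⁺ˡ; ∈-++⁺ʳ; map∷⁻; ∈-map⁺)
  open import Data.List.Relation.Unary.Unique.Propositional using (Unique)
  open import Data.List.Relation.Unary.AllPairs using ([])
  open import Data.List.Relation.Unary.Unique.Propositional.Properties using (++⁺)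
  open import Data.List.Relation.Binary.Disjoint.Propositional using (Disjoint)
  open import Data.Product using (∃-syntax; _×_; _,_; proj₁; proj₂)
  open import Data.Sum using (inj₁; inj₂)
  open import Relation.Binary.PropositionalEquality using (_≡_; refl; sym; subst)
  open import Relation.Nullary using (yes; no)

  bigs : ℕ → ℕ → List ℕ
  bigs n m = down (suc m) (n ∸ suc m)

  -- continuations n m k: the words  k−1, …, s+1 ++ n ∷ R  for s < k and
  -- R ∈ tails (down 1 s) (bigs n m); prefixed by m = k they are the counted
  -- permutations with first letter m.
  continuations : ℕ → ℕ → ℕ → List (List ℕ)
  continuations n m zero = []
  continuations n m (suc k) = consAll n (tails (down 1 k) (bigs n m)) ++ consAll k (continuations n m k)

  -- The counted words whose first letter is at most i.
  firstAtMost : ℕ → ℕ → List (List ℕ)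
  firstAtMost n zero = []
  firstAtMost n (suc i) = consAll (suc i) (continuations n (suc i) (suc i)) ++ firstAtMost n i

  countedList : ℕ → List (List ℕ)
  countedList n = firstAtMost n (n ∸ 2)

  Shape : ℕ → List ℕ → Set
  Shape n π = ∃[ s ] ∃[ j ] ∃[ R ] (suc (s + j) ≤ n ∸ 2 × π ≡ down (suc s) (suc j) ++ n ∷ R ×
    R ∈ tails (down 1 s) (bigs n (suc (s + j))))

  ∈-continuations⁻ : ∀ n m k {π} → π ∈ continuations n m (suc k) →
    ∃[ s ] ∃[ j ] ∃[ R ] (s + j ≡ k × π ≡ down (suc s) j ++ n ∷ R × R ∈ tails (down 1 s) (bigs n m))
  ∈-continuations⁻ n m k π∈ with ∈-++⁻ (consAll n (tails (down 1 k) (bigs n m))) π∈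
  ... | inj₁ π∈₁ with map∷⁻ π∈₁
  ... | R , R∈ , refl = k , 0 , R , +-identityʳ k , refl , R∈
  ∈-continuations⁻ n m (suc k) π∈ | inj₂ π∈₂ with map∷⁻ π∈₂
  ... | π' , π'∈ , refl with ∈-continuations⁻ n m k π'∈
  ... | s , j , R , refl , refl , R∈ = s , suc j , R , +-suc s j , refl , R∈

  ∈-continuations⁺ : ∀ n m s j R → R ∈ tails (down 1 s) (bigs n m) →
    (down (suc s) j ++ n ∷ R) ∈ continuations n m (suc (s + j))
  ∈-continuations⁺ n m s zero R R∈ =
    subst (λ k → (n ∷ R) ∈ continuations n m (suc k)) (sym (+-identityʳ s)) (∈-++⁺ˡ (∈-map⁺ (n ∷_) R∈))
  ∈-continuations⁺ n m s (suc j) R R∈ =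
    subst (λ k → (down (suc s) (suc j) ++ n ∷ R) ∈ continuations n m (suc k)) (sym (+-suc s j))
      (∈-++⁺ʳ (consAll n (tails (down 1 (suc (s + j))) (bigs n m)))
        (∈-map⁺ (suc (s + j) ∷_) (∈-continuations⁺ n m s j R R∈)))

  ∈-firstAtMost⁻ : ∀ n i {π} → π ∈ firstAtMost n i →
    ∃[ s ] ∃[ j ] ∃[ R ] (suc (s + j) ≤ i × π ≡ down (suc s) (suc j) ++ n ∷ R ×
      R ∈ tails (down 1 s) (bigs n (suc (s + j))))
  ∈-firstAtMost⁻ n (suc i) π∈ with ∈-++⁻ (consAll (suc i) (continuations n (suc i) (suc i))) π∈
  ... | inj₁ π∈₁ with map∷⁻ π∈₁
  ... | π' , π'∈ , refl with ∈-continuations⁻ n (suc i) i π'∈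
  ... | s , j , R , refl , refl , R∈ = s , j , R , ≤-refl , refl , R∈
  ∈-firstAtMost⁻ n (suc i) π∈ | inj₂ π∈₂ with ∈-firstAtMost⁻ n i π∈₂
  ... | s , j , R , m≤i , e , R∈ = s , j , R , ≤-trans m≤i (n≤1+n i) , e , R∈

  ∈-firstAtMost⁺ : ∀ n i s j R → suc (s + j) ≤ i → R ∈ tails (down 1 s) (bigs n (suc (s + j))) →
    (down (suc s) (suc j) ++ n ∷ R) ∈ firstAtMost n i
  ∈-firstAtMost⁺ n (suc i) s j R m≤i R∈ with suc (s + j) ≟ suc i
  ... | yes refl = ∈-++⁺ˡ (∈-map⁺ (suc (s + j) ∷_) (∈-continuations⁺ n (suc (s + j)) s j R R∈))
  ... | no m≢ = ∈-++⁺ʳ (consAll (suc i) (continuations n (suc i) (suc i)))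
                  (∈-firstAtMost⁺ n i s j R (≤-pred (≤∧≢⇒< m≤i m≢)) R∈)

  countedList⁻ : ∀ n {π} → π ∈ countedList n → Shape n π
  countedList⁻ n = ∈-firstAtMost⁻ n (n ∸ 2)

  countedList⁺ : ∀ n {π} → Shape n π → π ∈ countedList n
  countedList⁺ n (s , j , R , m≤ , refl , R∈) = ∈-firstAtMost⁺ n (n ∸ 2) s j R m≤ R∈

  smalls<bigs : ∀ {k m n} → suc k ≤ m → SmallBelowBig (down 1 k) (bigs n m)
  smalls<bigs k<m s∈ b∈ =
    <-≤-trans (<-≤-trans (proj₂ (∈-down⁻ s∈)) k<m) (≤-trans (n≤1+n _) (proj₁ (∈-down⁻ b∈)))

  unique-continuations : ∀ n m k → k ≤ m → m < n → Unique (continuations n m k)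
  unique-continuations n m zero _ _ = []
  unique-continuations n m (suc k) k<m m<n =
    ++⁺ (unique-consAll (unique-tails (down 1 k) (bigs n m) (down-desc (suc m) _) (smalls<bigs {n = n} k<m)))
        (unique-consAll (unique-continuations n m k (≤-trans (n≤1+n k) k<m) m<n))
        (disjoint-consAll (λ e → <-irrefl (sym e) (<-trans (<-≤-trans (n<1+n k) k<m) m<n)))

  head-firstAtMost : ∀ n i {π} → π ∈ firstAtMost n i → ∃[ x ] ∃[ π' ] (π ≡ x ∷ π' × x ≤ i)
  head-firstAtMost n (suc i) π∈ with ∈-++⁻ (consAll (suc i) (continuations n (suc i) (suc i))) π∈
  ... | inj₁ π∈₁ with map∷⁻ π∈₁
  ... | π' , _ , e = suc i , π' , e , ≤-refl
  head-firstAtMost n (suc i) π∈ | inj₂ π∈₂ with head-firstAtMost n i π∈₂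
  ... | x , π' , e , x≤i = x , π' , e , ≤-trans x≤i (n≤1+n i)

  unique-firstAtMost : ∀ n i → i < n → Unique (firstAtMost n i)
  unique-firstAtMost n zero _ = []
  unique-firstAtMost n (suc i) i<n =
    ++⁺ (unique-consAll (unique-continuations n (suc i) (suc i) ≤-refl i<n))
        (unique-firstAtMost n i (<-trans (n<1+n i) i<n)) newFirst
    where
    newFirst : Disjoint (consAll (suc i) (continuations n (suc i) (suc i))) (firstAtMost n i)
    newFirst (π∈₁ , π∈₂) with map∷⁻ π∈₁ | head-firstAtMost n i π∈₂
    ... | _ , _ , refl | _ , _ , refl , x≤i = <-irrefl refl (s≤s x≤i)

  unique-countedList : ∀ n → Unique (countedList n)
  unique-countedList zero = []
  unique-countedList (suc n) = unique-firstAtMost (suc n) (n ∸ 1) (s≤s (m∸n≤m n 1))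

module Run (n s j : Data.Nat.ℕ) (m≤ : Data.Nat._≤_ (Data.Nat.suc (s Data.Nat.+ j)) (n Data.Nat.∸ 2)) where

  open Descending
  open Intervals
  open CountedList using (bigs)
  open import Data.Nat using (ℕ; suc; _+_; _∸_; _<_; _≤_; _<?_; _≤?_; _≟_; z≤n; s≤s)
  open import Data.Nat.Properties
  open import Data.List using (List; _∷_; _++_; applyUpTo)
  open import Data.List.Membership.Propositional using (_∈_)
  open import Data.List.Membership.Propositional.Properties using (∈-++⁻; ∈-++⁺ˡ; ∈-++⁺ʳ)
  open import Data.List.Relation.Unary.Any using (here; there)
  import Data.List.Relation.Unary.All as All
  open import Data.List.Relation.Unary.AllPairs using (_∷_)
  open import Data.List.Relation.Binary.Permutation.Propositional using (_↭_)
  open import Data.Product using (_×_; _,_; proj₁; proj₂)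
  open import Data.Sum using (inj₁; inj₂)
  open import Relation.Binary.PropositionalEquality using (_≡_; refl; sym; subst)
  open import Relation.Nullary using (yes; no)

  m a : ℕ
  m = suc (s + j)
  a = suc s

  D Ss Bs : List ℕ
  D = down a (suc j)
  Ss = down 1 s
  Bs = bigs n m

  a≤m : a ≤ m
  a≤m = s≤s (m≤m+n s j)

  m+1<n : suc m < n
  m+1<n = +2≤ n m≤
    where
    +2≤ : ∀ n' {k} → suc k ≤ n' ∸ 2 → suc (suc k) < n'
    +2≤ (suc (suc n')) k≤ = s≤s (s≤s k≤)

  m<n : m < n
  m<n = <-trans (n<1+n m) m+1<n

  ∈D⁻ : ∀ {y} → y ∈ D → a ≤ y × y ≤ m
  ∈D⁻ {y} y∈ with ∈-down⁻ y∈
  ... | a≤y , y< = a≤y , ≤-pred (subst (y <_) (+-suc a j) y<)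

  ∈D⁺ : ∀ {y} → a ≤ y → y ≤ m → y ∈ D
  ∈D⁺ {y} a≤y y≤m = ∈-down⁺ a≤y (subst (y <_) (sym (+-suc a j)) (s≤s y≤m))

  bigs-top : suc m + (n ∸ suc m) ≡ n
  bigs-top = m+[n∸m]≡n (<⇒≤ m+1<n)

  ∈B⁻ : ∀ {y} → y ∈ Bs → m < y × y < n
  ∈B⁻ {y} y∈ with ∈-down⁻ y∈
  ... | m<y , y< = m<y , subst (y <_) bigs-top y<

  ∈B⁺ : ∀ {y} → m < y → y < n → y ∈ Bs
  ∈B⁺ {y} m<y y<n = ∈-down⁺ m<y (subst (y <_) (sym bigs-top) y<n)

  ∈S⁻ : ∀ {y} → y ∈ Ss → 1 ≤ y × y < a
  ∈S⁻ = ∈-down⁻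

  ∈S⁺ : ∀ {y} → 1 ≤ y → y < a → y ∈ Ss
  ∈S⁺ = ∈-down⁺

  small<big : ∀ {x y} → x ∈ Ss → y ∈ Bs → x < y
  small<big x∈ y∈ = <-trans (<-≤-trans (proj₂ (∈S⁻ x∈)) a≤m) (proj₁ (∈B⁻ y∈))

  letters : List ℕ
  letters = (n ∷ Bs) ++ (D ++ Ss)

  letters-desc : Desc letters
  letters-desc =
    desc-++ (All.tabulate (λ y∈ → proj₂ (∈B⁻ y∈)) ∷ down-desc (suc m) _)
            (desc-++ (down-desc a (suc j)) (down-desc 1 s) (λ x∈ y∈ → <-≤-trans (proj₂ (∈S⁻ y∈)) (proj₁ (∈D⁻ x∈))))
            above-m
    where
    ≤m : ∀ {y} → y ∈ D ++ Ss → y ≤ m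
    ≤m y∈ with ∈-++⁻ D y∈
    ... | inj₁ y∈D = proj₂ (∈D⁻ y∈D)
    ... | inj₂ y∈S = ≤-trans (<⇒≤ (proj₂ (∈S⁻ y∈S))) a≤m
    >m : ∀ {x} → x ∈ n ∷ Bs → m < x
    >m (here refl) = m<n
    >m (there x∈) = proj₁ (∈B⁻ x∈)
    above-m : ∀ {x y} → x ∈ n ∷ Bs → y ∈ D ++ Ss → y < x
    above-m x∈ y∈ = ≤-<-trans (≤m y∈) (>m x∈)

  ∈letters⁻ : ∀ {y} → y ∈ letters → 1 ≤ y × y < suc n
  ∈letters⁻ (here refl) = ≤-trans (s≤s z≤n) (<⇒≤ m<n) , ≤-refl
  ∈letters⁻ (there y∈) with ∈-++⁻ Bs y∈
  ... | inj₁ y∈B = ≤-trans (s≤s z≤n) (proj₁ (∈B⁻ y∈B)) , <-trans (proj₂ (∈B⁻ y∈B)) (n<1+n n)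
  ... | inj₂ y∈' with ∈-++⁻ D y∈'
  ... | inj₁ y∈D = ≤-trans (s≤s z≤n) (proj₁ (∈D⁻ y∈D)) , s≤s (<⇒≤ (≤-<-trans (proj₂ (∈D⁻ y∈D)) m<n))
  ... | inj₂ y∈S = proj₁ (∈S⁻ y∈S) , s≤s (<⇒≤ (<-≤-trans (proj₂ (∈S⁻ y∈S)) (≤-trans a≤m (<⇒≤ m<n))))

  ∈letters⁺ : ∀ {y} → 1 ≤ y → y < suc n → y ∈ letters
  ∈letters⁺ {y} 1≤y y≤n with y <? a
  ... | yes y<a = there (∈-++⁺ʳ Bs (∈-++⁺ʳ D (∈S⁺ 1≤y y<a)))
  ... | no y≮a with y ≤? m
  ... | yes y≤m = there (∈-++⁺ʳ Bs (∈-++⁺ˡ (∈D⁺ (≮⇒≥ y≮a) y≤m)))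
  ... | no y≰m with y ≟ n
  ... | yes refl = here refl
  ... | no y≢n = there (∈-++⁺ˡ (∈B⁺ (≰⇒> y≰m) (≤∧≢⇒< (≤-pred y≤n) y≢n)))

  letters↭ : letters ↭ applyUpTo suc n
  letters↭ = same-members⇒↭ letters (applyUpTo suc n) (desc⇒unique letters-desc) (upTo-unique 1 n)
    (λ y∈ → ∈-upTo⁺ {1} {n} (proj₁ (∈letters⁻ y∈)) (proj₂ (∈letters⁻ y∈)))
    (λ y∈ → ∈letters⁺ (proj₁ (∈-upTo⁻ {1} {n} y∈)) (proj₂ (∈-upTo⁻ {1} {n} y∈)))

module Soundness where

  open import Defs
  open Subsequences
  open Descending
  open Intervals
  open Patterns
  open Positions
  open Tails
  open CountedList using (Shape)
  open import Data.Nat using (suc; _+_; _<_; _≤_; _≤?_; s≤s)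
  open import Data.Nat.Properties using (<-asym; ≤-pred; ≰⇒>; ≤-<-trans; <⇒≱; <-≤-trans; <-trans; ≤-trans; n≤1+n)
  open import Data.List using ([]; _∷_; _++_; length; take; applyUpTo)
  open import Data.List.Properties using (++-assoc; length-applyDownFrom)
  open import Data.List.Membership.Propositional using (_∈_)
  open import Data.List.Membership.Propositional.Properties using (∈-++⁻; map∷⁻)
  open import Data.List.Relation.Unary.Any using (here; there)
  open import Data.List.Relation.Binary.Permutation.Propositional using (_↭_; ↭-refl; ↭-trans; ↭-sym; prep; swap)
  open import Data.List.Relation.Binary.Permutation.Propositional.Properties using (shift; shifts) renaming (++⁺ˡ to ↭-++⁺ˡ)
  open import Data.Product using (_,_; proj₁; proj₂)
  open import Data.Sum using (inj₁; inj₂)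
  open import Data.Empty using (⊥-elim)
  open import Relation.Binary.PropositionalEquality using (_≡_; refl; sym; trans; cong; subst; subst₂)
  open import Relation.Nullary using (yes; no)

  mutual
    tails↭ : ∀ Ss Bs {R} → R ∈ tails Ss Bs → R ↭ Bs ++ Ss
    tails↭ Ss Bs R∈ with ∈-++⁻ (tailsEmpty Ss Bs) R∈
    tails↭ [] [] R∈ | inj₁ (here refl) = ↭-refl
    tails↭ Ss Bs R∈ | inj₂ R∈₁ with ∈-++⁻ (tailsSmall Ss Bs) R∈₁
    tails↭ (s ∷ Ss) Bs R∈ | inj₂ R∈₁ | inj₁ R∈₂ with map∷⁻ R∈₂
    ... | R' , R'∈ , refl = ↭-trans (prep s (tails↭ Ss Bs R'∈)) (↭-sym (shift s Bs Ss))
    tails↭ Ss Bs R∈ | inj₂ R∈₁ | inj₂ R∈₂ with ∈-++⁻ (tailsBig Ss Bs) R∈₂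
    tails↭ Ss (b ∷ Bs) R∈ | inj₂ R∈₁ | inj₂ R∈₂ | inj₁ R∈₃ with map∷⁻ R∈₃
    ... | R' , R'∈ , refl = prep b (tails↭ Ss Bs R'∈)
    tails↭ Ss (c ∷ r ∷ Bs) R∈ | inj₂ R∈₁ | inj₂ R∈₂ | inj₂ R∈₃ with map∷⁻ R∈₃
    ... | R' , R'∈ , refl = ↭-trans (prep r (pending↭ Ss c Bs R'∈)) (swap r c ↭-refl)

    pending↭ : ∀ Ss c Bs {R} → R ∈ pending Ss c Bs → R ↭ c ∷ (Bs ++ Ss)
    pending↭ Ss c Bs (here refl) = ↭-refl
    pending↭ Ss c Bs (there R∈) with ∈-++⁻ (pendingSmall Ss c Bs) R∈
    pending↭ (s ∷ Ss) c Bs (there R∈) | inj₁ R∈₁ with map∷⁻ R∈₁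
    ... | R' , R'∈ , refl =
      ↭-trans (prep s (pending↭ Ss c Bs R'∈)) (↭-trans (swap s c ↭-refl) (prep c (↭-sym (shift s Bs Ss))))
    pending↭ Ss c (b ∷ Bs) (there R∈) | inj₂ R∈₂ with map∷⁻ R∈₂
    ... | R' , R'∈ , refl = ↭-trans (prep b (pending↭ Ss c Bs R'∈)) (swap b c ↭-refl)

  shape⇒counted : ∀ n {π} → Shape n π → Counted n π
  shape⇒counted n (s , j , R , m≤ , refl , R∈) =
    isPerm , Av⇒avoids avoids , (m , down a j ++ n ∷ R , refl , m≤) ,
    (suc j , ((a , n , at-a , at-n , ≤-<-trans a≤m m<n) , leftmost) , at-n , consecutive)
    where
    open Run n s j m≤
    π = D ++ n ∷ R
    lenD : length D ≡ suc j
    lenD = length-applyDownFrom (a +_) (suc j)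

    isPerm : IsPerm n π
    isPerm = ↭-trans (↭-trans (↭-++⁺ˡ D (prep n (tails↭ Ss Bs R∈))) (shifts D (n ∷ Bs) {Ss})) letters↭

    -- After D ++ [n] the invariant of TailSoundness holds with θ = m + 1.
    avoids : Av π
    avoids = subst Av (++-assoc D (n ∷ []) R) (av-tails Ss Bs (D ++ n ∷ []) R R∈ L I)
      where
      open TailSoundness (suc m)
      L : Letters Ss Bs
      L = record { small-desc = down-desc 1 s ; big-desc = down-desc (suc m) _
                 ; low = λ s∈ → <-≤-trans (proj₂ (∈S⁻ s∈)) (≤-trans a≤m (n≤1+n m))
                 ; high = λ b∈ → proj₁ (∈B⁻ b∈) }
      I : Prefix (D ++ n ∷ []) Ss Bs
      I = record
        { avoids = av-snoc D (desc-avoids (down-desc a (suc j))) (desc-noBadEnd (down-desc a (suc j)))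
        ; above-smalls = λ y∈ s∈ → above y∈ s∈
        ; crossing = cross
        ; high-above = highA
        }
        where
        above : ∀ {y x} → y ∈ D ++ n ∷ [] → x ∈ Ss → x < y
        above y∈ x∈ with snoc-mem D y∈
        ... | inj₁ y∈D = <-≤-trans (proj₂ (∈S⁻ x∈)) (proj₁ (∈D⁻ y∈D))
        ... | inj₂ refl = <-trans (<-≤-trans (proj₂ (∈S⁻ x∈)) a≤m) m<n
        cross : Crossing (D ++ n ∷ [])
        cross s p<q with snoc-pair D s
        ... | inj₁ t = ⊥-elim (<-asym p<q (desc-pair (down-desc a (suc j)) t))
        ... | inj₂ (refl , p∈) = s≤s (proj₂ (∈D⁻ p∈)) , m<n
        highA : HighAbove (D ++ n ∷ []) Bs
        highA y∈ θ≤y v∈ with snoc-mem D y∈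
        ... | inj₁ y∈D = ⊥-elim (<⇒≱ (s≤s (proj₂ (∈D⁻ y∈D))) θ≤y)
        ... | inj₂ refl = proj₂ (∈B⁻ v∈)

    at-n : At π (suc (suc j)) n
    at-n = D , R , refl , cong suc lenD

    at-a : At π (suc j) a
    at-a = down (suc a) j , n ∷ R ,
           trans (cong (_++ n ∷ R) (down-last a j)) (++-assoc (down (suc a) j) (a ∷ []) (n ∷ R)) ,
           cong suc (length-applyDownFrom (suc a +_) j)

    -- No ascent inside the decreasing run D.
    leftmost : ∀ i → Ascent π i → suc j ≤ i
    leftmost i (u' , v' , at-u , at-v , u'<v') with suc j ≤? i
    ... | yes le = le
    ... | no nle with at-positive at-u
    leftmost (suc k) (u' , v' , at-u , at-v , u'<v') | no nle | _
      with split-adjacent D k (subst (suc (suc k) ≤_) (sym lenD) (s≤s (≤-pred (≰⇒> nle))))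
    ... | D₁ , u , v , D₂ , eq , refl =
      ⊥-elim (<-asym u'<v' (subst₂ _<_ (sym v'≡v) (sym u'≡u)
        (desc-pair (down-desc a (suc j)) (subst ((u ∷ v ∷ []) ⊆_) (sym eq) (++⁺ˡ D₁ (refl ∷ refl ∷ minimum D₂))))))
      where
      π≡ : π ≡ (D₁ ++ u ∷ v ∷ D₂) ++ n ∷ R
      π≡ = cong (_++ n ∷ R) eq
      u'≡u : u' ≡ u
      u'≡u = at-unique at-u (subst (λ w → At w (suc (length D₁)) u) (sym π≡) (proj₁ (at-adjacent D₁ u v D₂ (n ∷ R))))
      v'≡v : v' ≡ v
      v'≡v = at-unique at-v (subst (λ w → At w (suc (suc (length D₁))) v) (sym π≡) (proj₂ (at-adjacent D₁ u v D₂ (n ∷ R))))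

    consecutive : ConsecutiveSet (take (suc j) π)
    consecutive = a , subst (λ L → L ↭ applyUpTo (a +_) (length L)) (sym take-D)
                        (subst (λ k → D ↭ applyUpTo (a +_) k) (sym lenD) (down↭upTo a (suc j)))
      where
      take-D : take (suc j) π ≡ D
      take-D = subst (λ k → take k π ≡ D) lenD (take-prefix D (n ∷ R))

module Completeness where

  open import Defs
  open Subsequences
  open Descending
  open Intervals
  open Patterns
  open Positions
  open Tails
  open CountedList using (Shape)
  open import Data.Nat using (ℕ; zero; suc; _+_; _∸_; _<_; _≤_; z≤n; s≤s)
  open import Data.Nat.Properties using (<⇒≱; ≤-refl; ≤-trans; ≤-reflexive; ≤-<-trans; <-≤-trans; m≤m+n; +-suc)
  open import Data.List using (List; []; _∷_; _++_; length; applyUpTo)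
  open import Data.List.Properties using (++-assoc; length-++; ∷-injectiveˡ)
  open import Data.List.Membership.Propositional using (_∈_)
  open import Data.List.Membership.Propositional.Properties using (∈-++⁺ˡ)
  open import Data.List.Relation.Unary.Unique.Propositional using (Unique)
  open import Data.List.Relation.Unary.Unique.Propositional.Properties using (take⁺)
  open import Data.List.Relation.Binary.Permutation.Propositional using (_↭_; ↭-trans; ↭-sym)
  open import Data.List.Relation.Binary.Permutation.Propositional.Properties using (∈-resp-↭; drop-∷; shifts)
  open import Data.Product using (_,_; proj₁; proj₂)
  open import Relation.Binary.PropositionalEquality using (_≡_; refl; sym; trans; cong; subst)
  open import Relation.Nullary using (¬_)

  ↭-cancelˡ : ∀ (xs : List ℕ) {ys zs} → xs ++ ys ↭ xs ++ zs → ys ↭ zs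
  ↭-cancelˡ [] p = p
  ↭-cancelˡ (x ∷ xs) p = ↭-cancelˡ xs (drop-∷ p)

  before-ascent-desc : ∀ (P rest : List ℕ) → Unique P → (∀ i → Ascent (P ++ rest) i → length P ≤ i) → Desc P
  before-ascent-desc P rest uP leftmost = desc-from-adjacent P uP noAscent
    where
    noAscent : ∀ D₁ u v D₂ → P ≡ D₁ ++ u ∷ v ∷ D₂ → ¬ u < v
    noAscent D₁ u v D₂ refl u<v =
      <⇒≱ inside (leftmost (suc (length D₁)) (u , v , proj₁ adjacent , proj₂ adjacent , u<v))
      where
      adjacent = at-adjacent D₁ u v D₂ rest
      inside : suc (length D₁) < length (D₁ ++ u ∷ v ∷ D₂)
      inside = ≤-trans (s≤s (s≤s (m≤m+n (length D₁) (length D₂))))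
        (≤-reflexive (sym (trans (length-++ D₁) (trans (+-suc (length D₁) _) (cong suc (+-suc (length D₁) _))))))

  run-shape : ∀ n s j suf {π} → π ≡ down (suc s) (suc j) ++ n ∷ suf → suc (s + j) ≤ n ∸ 2 →
    Avoids T π → IsPerm n π → Shape n π
  run-shape n s j suf refl m≤ avoids perm =
    s , j , suf , m≤ , refl , complete-tails Ss Bs (D ++ n ∷ []) suf C av (drop-∷ (↭-cancelˡ D rearranged))
    where
    open Run n s j m≤
    open TailCompleteness m n a m<n
    rearranged : D ++ n ∷ suf ↭ D ++ n ∷ (Bs ++ Ss)
    rearranged = ↭-trans perm (↭-trans (↭-sym letters↭) (shifts (n ∷ Bs) D))
    av : Av ((D ++ n ∷ []) ++ suf)
    av = subst Av (sym (++-assoc D (n ∷ []) suf)) (avoids⇒Av avoids)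
    C : Context (D ++ n ∷ []) Ss Bs
    C = record
      { small-desc = down-desc 1 s ; big-desc = down-desc (suc m) _
      ; small<m = λ s∈ → <-≤-trans (proj₂ (∈S⁻ s∈)) a≤m
      ; a<big = λ b∈ → ≤-<-trans a≤m (proj₁ (∈B⁻ b∈))
      ; small<big = small<big
      ; m-then-n = refl ∷ ++⁺ˡ (down a j) (refl ∷ [])
      ; a∈P = ∈-++⁺ˡ (∈D⁺ ≤-refl a≤m) }

  -- A counted permutation is P ++ n ∷ suf with P = take j π the initial descent
  -- sequence; P decreases and is consecutive, hence P = down a j.
  counted⇒shape : ∀ n {π} → Counted n π → Shape n π
  counted⇒shape n (perm , avoids , (x , _ , π≡ , x≤) ,
                   (_ , ((_ , _ , at-u , _ , _) , leftmost) , (P , suf , refl , refl) , (a , consecutive))) =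
    from-run a (length P) (at-positive at-u) P≡down
    where
    π = P ++ n ∷ suf
    unique-π : Unique π
    unique-π = unique-resp-↭ (↭-sym perm) (upTo-unique 1 n)
    unique-P : Unique P
    unique-P = subst Unique (take-prefix P (n ∷ suf)) (take⁺ (length P) unique-π)
    P≡down : P ≡ down a (length P)
    P≡down = desc↭upTo⇒down a (length P) (before-ascent-desc P (n ∷ suf) unique-P leftmost)
      (subst (λ L → L ↭ applyUpTo (a +_) (length L)) (take-prefix P (n ∷ suf)) consecutive)
    -- The run is down a k with k ≥ 1, and a ≥ 1 since 0 is not a letter of π.
    from-run : ∀ a k → 1 ≤ k → P ≡ down a k → Shape n π
    from-run zero (suc k) _ P≡ with ∈-upTo⁻ {1} {n} (∈-resp-↭ perm (∈-++⁺ˡ (subst (0 ∈_) (sym P≡) (∈-down⁺ z≤n (s≤s z≤n)))))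
    ... | () , _
    from-run (suc s) (suc j) _ P≡ = run-shape n s j suf (cong (_++ n ∷ suf) P≡) bound avoids perm
      where
      bound : suc (s + j) ≤ n ∸ 2
      bound = subst (_≤ n ∸ 2) (∷-injectiveˡ (trans (sym π≡) (cong (_++ n ∷ suf) P≡))) x≤

-- The length of countedList n.  The number of tails depends only on the numbers
-- s = |Ss| and b = |Bs| of letters, through recurrences mirroring the grammar.
module Lengths where

  open Tails
  open Intervals using (down)
  open CountedList
  open import Data.Nat using (ℕ; zero; suc; _+_; _∸_)
  open import Data.Nat.Properties using (+-suc; m+n∸m≡n)
  open import Data.List using (List; []; _∷_; length)
  open import Data.List.Properties using (length-++; length-map; length-applyDownFrom)
  open import Relation.Binary.PropositionalEquality using (_≡_; refl; sym; trans; cong; cong₂)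

  mutual
    #tails : ℕ → ℕ → ℕ
    #tails s b = #empty s b + (#small s b + (#big s b + #second s b))

    #empty : ℕ → ℕ → ℕ
    #empty zero zero = 1
    #empty zero (suc _) = 0
    #empty (suc _) _ = 0

    #small : ℕ → ℕ → ℕ
    #small zero b = 0
    #small (suc s) b = #tails s b

    #big : ℕ → ℕ → ℕ
    #big s zero = 0
    #big s (suc b) = #tails s b

    #second : ℕ → ℕ → ℕ
    #second s zero = 0
    #second s (suc zero) = 0
    #second s (suc (suc b)) = #pending s b

    #pending : ℕ → ℕ → ℕ
    #pending s b = suc (#pendingSmall s b + #pendingBig s b)

    #pendingSmall : ℕ → ℕ → ℕ
    #pendingSmall zero b = 0
    #pendingSmall (suc s) b = #pending s b

    #pendingBig : ℕ → ℕ → ℕ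
    #pendingBig s zero = 0
    #pendingBig s (suc b) = #pending s b

  length-consAll : ∀ x (Ls : List (List ℕ)) → length (consAll x Ls) ≡ length Ls
  length-consAll x = length-map (x ∷_)

  mutual
    length-tails : ∀ Ss Bs → length (tails Ss Bs) ≡ #tails (length Ss) (length Bs)
    length-tails Ss Bs =
      trans (length-++ (tailsEmpty Ss Bs)) (cong₂ _+_ (length-empty Ss Bs)
        (trans (length-++ (tailsSmall Ss Bs)) (cong₂ _+_ (length-small Ss Bs)
          (trans (length-++ (tailsBig Ss Bs)) (cong₂ _+_ (length-big Ss Bs) (length-second Ss Bs))))))

    length-empty : ∀ Ss Bs → length (tailsEmpty Ss Bs) ≡ #empty (length Ss) (length Bs)
    length-empty [] [] = refl
    length-empty [] (_ ∷ _) = refl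
    length-empty (_ ∷ _) _ = refl

    length-small : ∀ Ss Bs → length (tailsSmall Ss Bs) ≡ #small (length Ss) (length Bs)
    length-small [] Bs = refl
    length-small (s ∷ Ss) Bs = trans (length-consAll s (tails Ss Bs)) (length-tails Ss Bs)

    length-big : ∀ Ss Bs → length (tailsBig Ss Bs) ≡ #big (length Ss) (length Bs)
    length-big Ss [] = refl
    length-big Ss (b ∷ Bs) = trans (length-consAll b (tails Ss Bs)) (length-tails Ss Bs)

    length-second : ∀ Ss Bs → length (tailsSecond Ss Bs) ≡ #second (length Ss) (length Bs)
    length-second Ss [] = refl
    length-second Ss (_ ∷ []) = refl
    length-second Ss (c ∷ r ∷ Bs) = trans (length-consAll r (pending Ss c Bs)) (length-pending Ss c Bs)

    length-pending : ∀ Ss c Bs → length (pending Ss c Bs) ≡ #pending (length Ss) (length Bs)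
    length-pending Ss c Bs = cong suc (trans (length-++ (pendingSmall Ss c Bs))
      (cong₂ _+_ (length-pendingSmall Ss c Bs) (length-pendingBig Ss c Bs)))

    length-pendingSmall : ∀ Ss c Bs → length (pendingSmall Ss c Bs) ≡ #pendingSmall (length Ss) (length Bs)
    length-pendingSmall [] c Bs = refl
    length-pendingSmall (s ∷ Ss) c Bs = trans (length-consAll s (pending Ss c Bs)) (length-pending Ss c Bs)

    length-pendingBig : ∀ Ss c Bs → length (pendingBig Ss c Bs) ≡ #pendingBig (length Ss) (length Bs)
    length-pendingBig Ss c [] = refl
    length-pendingBig Ss c (b ∷ Bs) = trans (length-consAll b (pending Ss c Bs)) (length-pending Ss c Bs)

  #continuations : ℕ → ℕ → ℕ
  #continuations t zero = 0
  #continuations t (suc k) = #tails k t + #continuations t k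

  length-continuations : ∀ n m k → length (continuations n m k) ≡ #continuations (n ∸ suc m) k
  length-continuations n m zero = refl
  length-continuations n m (suc k) =
    trans (length-++ (consAll n (tails (down 1 k) (bigs n m))))
      (cong₂ _+_
        (trans (length-consAll n (tails (down 1 k) (bigs n m)))
          (trans (length-tails (down 1 k) (bigs n m))
            (cong₂ #tails (length-applyDownFrom (1 +_) k) (length-applyDownFrom (suc m +_) _))))
        (trans (length-consAll k (continuations n m k)) (length-continuations n m k)))

  -- #firstAtMost i j counts firstAtMost (i + 1 + j) i: the first letter m ≤ i
  -- leaves n − 1 − m = j + i − m big letters.
  #firstAtMost : ℕ → ℕ → ℕ
  #firstAtMost zero j = 0
  #firstAtMost (suc i) j = #continuations j (suc i) + #firstAtMost i (suc j)

  length-firstAtMost : ∀ i j → length (firstAtMost (suc i + j) i) ≡ #firstAtMost i j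
  length-firstAtMost zero j = refl
  length-firstAtMost (suc i) j =
    trans (length-++ (consAll (suc i) (continuations (suc (suc i) + j) (suc i) (suc i))))
      (cong₂ _+_
        (trans (length-consAll (suc i) (continuations (suc (suc i) + j) (suc i) (suc i)))
          (trans (length-continuations (suc (suc i) + j) (suc i) (suc i))
            (cong (λ t → #continuations t (suc i)) (m+n∸m≡n (suc (suc i)) j))))
        (trans (cong (λ n → length (firstAtMost n i)) (sym (+-suc (suc i) j))) (length-firstAtMost i (suc j))))

-- Closed forms.  diag f i j = f i j + f (i−1) (j+1) + … + f 0 (i+j) sums f along
-- an antidiagonal; the grammar recurrences turn into recurrences for the sums
-- over s + b = k of #tails and #pending, which are solved in closed form.
module Counting where

  open Lengths
  open import Data.Nat using (ℕ; zero; suc; _+_; _*_; _^_)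
  open import Data.Nat.Properties using (+-identityʳ; +-suc; +-comm; +-cancelʳ-≡; *-comm; ^-distribˡ-+-*)
  open import Data.Nat.Combinatorics using (_C_; nCk+nC[k+1]≡[n+1]C[k+1]; nC1≡n)
  open import Data.Nat.Tactic.RingSolver using (solve-∀)
  open import Relation.Binary.PropositionalEquality using (_≡_; refl; sym; trans; cong; cong₂; module ≡-Reasoning)

  diag : (ℕ → ℕ → ℕ) → ℕ → ℕ → ℕ
  diag f zero j = f 0 j
  diag f (suc i) j = f (suc i) j + diag f i (suc j)

  diag-+ : ∀ f g i j → diag (λ s t → f s t + g s t) i j ≡ diag f i j + diag g i j
  diag-+ f g zero j = refl
  diag-+ f g (suc i) j =
    trans (cong (f (suc i) j + g (suc i) j +_) (diag-+ f g i (suc j)))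
          (swap-middle (f (suc i) j) (g (suc i) j) (diag f i (suc j)) (diag g i (suc j)))
    where
    swap-middle : ∀ a b c d → a + b + (c + d) ≡ a + c + (b + d)
    swap-middle = solve-∀

  diag-suc : ∀ f i j → diag (λ s t → suc (f s t)) i j ≡ suc i + diag f i j
  diag-suc f zero j = refl
  diag-suc f (suc i) j =
    trans (cong (suc (f (suc i) j) +_) (diag-suc f i (suc j))) (rearrange (f (suc i) j) i (diag f i (suc j)))
    where
    rearrange : ∀ a b c → suc a + (suc b + c) ≡ suc (suc b) + (a + c)
    rearrange = solve-∀

  -- Branches that consume a small letter shift the diagonal in the first
  -- coordinate, branches consuming k big letters in the second.
  diag-shiftˡ : ∀ f g → (∀ t → f 0 t ≡ 0) → (∀ s t → f (suc s) t ≡ g s t) → ∀ i j → diag f (suc i) j ≡ diag g i j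
  diag-shiftˡ f g f0 fs zero j = trans (cong₂ _+_ (fs 0 j) (f0 (suc j))) (+-identityʳ _)
  diag-shiftˡ f g f0 fs (suc i) j = cong₂ _+_ (fs (suc i) j) (diag-shiftˡ f g f0 fs i (suc j))

  diag-shiftʳ : ∀ k f g → (∀ s t → f s (k + t) ≡ g s t) → ∀ i j → diag f i (k + j) ≡ diag g i j
  diag-shiftʳ k f g fk zero j = fk 0 j
  diag-shiftʳ k f g fk (suc i) j =
    cong₂ _+_ (fk (suc i) j) (trans (cong (diag f i) (sym (+-suc k j))) (diag-shiftʳ k f g fk i (suc j)))

  diag-empty : ∀ i j → diag #empty i (suc j) ≡ 0
  diag-empty zero j = refl
  diag-empty (suc i) j = diag-empty i (suc j)

  tailsDiag pendingDiag : ℕ → ℕ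
  tailsDiag k = diag #tails k 0
  pendingDiag k = diag #pending k 0

  -- Writing c, a small or a big letter: U(k+1) = (k+2) + 2·U(k) for the pending sums.
  pendingDiag-rec : ∀ k → pendingDiag (suc k) ≡ suc (suc k) + (pendingDiag k + pendingDiag k)
  pendingDiag-rec k =
    trans (diag-suc (λ s t → #pendingSmall s t + #pendingBig s t) (suc k) 0)
      (cong (suc (suc k) +_) (trans (diag-+ #pendingSmall #pendingBig (suc k) 0)
        (cong₂ _+_ (diag-shiftˡ #pendingSmall #pending (λ _ → refl) (λ _ _ → refl) k 0)
                   (diag-shiftʳ 1 #pendingBig #pending (λ _ _ → refl) k 0))))

  pendingDiag-closed : ∀ k → pendingDiag k + (k + 3) ≡ 2 ^ (k + 2)
  pendingDiag-closed zero = refl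
  pendingDiag-closed (suc k) = begin
      pendingDiag (suc k) + (suc k + 3)
    ≡⟨ cong (_+ (suc k + 3)) (pendingDiag-rec k) ⟩
      suc (suc k) + (pendingDiag k + pendingDiag k) + (suc k + 3)
    ≡⟨ double (pendingDiag k) k ⟩
      2 * (pendingDiag k + (k + 3))
    ≡⟨ cong (2 *_) (pendingDiag-closed k) ⟩
      2 * 2 ^ (k + 2)
    ∎
    where
    open ≡-Reasoning
    double : ∀ u k → suc (suc k) + (u + u) + (suc k + 3) ≡ 2 * (u + (k + 3))
    double = solve-∀

  secondDiag : ℕ → ℕ
  secondDiag zero = 0
  secondDiag (suc k) = pendingDiag k

  diag-second : ∀ k → diag #second (suc k) 0 ≡ secondDiag k
  diag-second zero = refl
  diag-second (suc k) = diag-shiftʳ 2 #second #pending (λ _ _ → refl) k 0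

  tailsDiag-rec : ∀ k → tailsDiag (suc k) ≡ tailsDiag k + (tailsDiag k + secondDiag k)
  tailsDiag-rec k = begin
      diag #tails (suc k) 0
    ≡⟨ diag-+ #empty (λ s t → #small s t + (#big s t + #second s t)) (suc k) 0 ⟩
      diag #empty (suc k) 0 + diag (λ s t → #small s t + (#big s t + #second s t)) (suc k) 0
    ≡⟨ cong (diag #empty (suc k) 0 +_) (trans (diag-+ #small _ (suc k) 0) (cong (diag #small (suc k) 0 +_) (diag-+ #big #second (suc k) 0))) ⟩
      diag #empty (suc k) 0 + (diag #small (suc k) 0 + (diag #big (suc k) 0 + diag #second (suc k) 0))
    ≡⟨ cong₂ _+_ (diag-empty k 0) (cong₂ _+_ (diag-shiftˡ #small #tails (λ _ → refl) (λ _ _ → refl) k 0)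
         (cong₂ _+_ (diag-shiftʳ 1 #big #tails (λ _ _ → refl) k 0) (diag-second k))) ⟩
      tailsDiag k + (tailsDiag k + secondDiag k)
    ∎
    where open ≡-Reasoning

  tailsDiag-step : ∀ k → tailsDiag (suc k) + 2 * 2 ^ suc k ≡ suc k * 2 ^ suc k + suc k + 3 →
    tailsDiag (suc (suc k)) + 2 * 2 ^ suc (suc k) ≡ suc (suc k) * 2 ^ suc (suc k) + suc (suc k) + 3
  tailsDiag-step k ih = +-cancelʳ-≡ _ _ _ (begin
      tailsDiag (suc (suc k)) + 2 * (2 * (2 * x)) + (k + 3)
    ≡⟨ cong (λ z → z + 2 * (2 * (2 * x)) + (k + 3)) (tailsDiag-rec (suc k)) ⟩
      w + (w + u) + 2 * (2 * (2 * x)) + (k + 3)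
    ≡⟨ regroup w u x k ⟩
      2 * (w + 2 * (2 * x)) + (u + (k + 3))
    ≡⟨ cong₂ (λ p q → 2 * p + q) ih (trans (pendingDiag-closed k) (trans (^-distribˡ-+-* 2 k 2) (*-comm x 4))) ⟩
      2 * (suc k * (2 * x) + suc k + 3) + 4 * x
    ≡⟨ expand k x ⟩
      suc (suc k) * (2 * (2 * x)) + suc (suc k) + 3 + (k + 3)
    ∎)
    where
    open ≡-Reasoning
    x = 2 ^ k
    w = tailsDiag (suc k)
    u = pendingDiag k
    regroup : ∀ w u x k → w + (w + u) + 2 * (2 * (2 * x)) + (k + 3) ≡ 2 * (w + 2 * (2 * x)) + (u + (k + 3))
    regroup = solve-∀
    expand : ∀ k x → 2 * (suc k * (2 * x) + suc k + 3) + 4 * x ≡ suc (suc k) * (2 * (2 * x)) + suc (suc k) + 3 + (k + 3)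
    expand = solve-∀

  tailsDiag-closed : ∀ k → tailsDiag k + 2 * 2 ^ k ≡ k * 2 ^ k + k + 3
  tailsDiag-closed zero = refl
  tailsDiag-closed (suc zero) = refl
  tailsDiag-closed (suc (suc k)) = tailsDiag-step k (tailsDiag-closed (suc k))

  #tails-no-big : ∀ s → #tails s 0 ≡ 1
  #tails-no-big zero = refl
  #tails-no-big (suc s) = trans (+-identityʳ _) (#tails-no-big s)

  #firstAtMost-step : ∀ i j → #firstAtMost (suc i) j ≡ diag #tails i j + #firstAtMost i j
  #firstAtMost-step zero j = +-identityʳ _
  #firstAtMost-step (suc i) j =
    trans (cong (#tails (suc i) j + #continuations j (suc i) +_) (#firstAtMost-step i (suc j)))
      (regroup (#tails (suc i) j) (#tails i j) (#continuations j i) (diag #tails i (suc j)) (#firstAtMost i (suc j)))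
    where
    regroup : ∀ a b c d e → a + (b + c) + (d + e) ≡ a + d + (b + c + e)
    regroup = solve-∀

  C3 : ℕ → ℕ
  C3 k = (k + 3) C 2

  C3-suc : ∀ k → C3 (suc k) ≡ C3 k + (k + 3)
  C3-suc k = begin
      (suc k + 3) C 2
    ≡⟨ sym (nCk+nC[k+1]≡[n+1]C[k+1] (k + 3) 1) ⟩
      (k + 3) C 1 + (k + 3) C 2
    ≡⟨ cong (_+ (k + 3) C 2) (nC1≡n (k + 3)) ⟩
      (k + 3) + C3 k
    ≡⟨ +-comm (k + 3) _ ⟩
      C3 k + (k + 3)
    ∎
    where open ≡-Reasoning

  -- For n = k + 2: #firstAtMost k 1 + 6·2ᵏ = 2k·2ᵏ + C(k+3, 2) + 3.
  #firstAtMost-closed : ∀ k → #firstAtMost k 1 + 6 * 2 ^ k ≡ 2 * k * 2 ^ k + C3 k + 3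
  #firstAtMost-closed zero = refl
  #firstAtMost-closed (suc k) = +-cancelʳ-≡ _ _ _ (begin
      #firstAtMost (suc k) 1 + 6 * (2 * x) + (1 + 2 * (2 * x))
    ≡⟨ cong (λ z → z + 6 * (2 * x) + (1 + 2 * (2 * x))) (#firstAtMost-step k 1) ⟩
      d + t + 6 * (2 * x) + (1 + 2 * (2 * x))
    ≡⟨ regroup d t x ⟩
      (1 + d + 2 * (2 * x)) + (t + 6 * x) + 6 * x
    ≡⟨ cong₂ (λ p q → p + q + 6 * x) diagonal (#firstAtMost-closed k) ⟩
      (suc k * (2 * x) + suc k + 3) + (2 * k * x + C3 k + 3) + 6 * x
    ≡⟨ expand k x (C3 k) ⟩
      2 * suc k * (2 * x) + (C3 k + (k + 3)) + 3 + (1 + 2 * (2 * x))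
    ≡⟨ cong (λ z → 2 * suc k * (2 * x) + z + 3 + (1 + 2 * (2 * x))) (sym (C3-suc k)) ⟩
      2 * suc k * (2 * x) + C3 (suc k) + 3 + (1 + 2 * (2 * x))
    ∎)
    where
    open ≡-Reasoning
    x = 2 ^ k
    d = diag #tails k 1
    t = #firstAtMost k 1
    -- The antidiagonal starting at (k, 1) is tailsDiag (k+1) without #tails (k+1) 0 = 1.
    diagonal : 1 + d + 2 * (2 * x) ≡ suc k * (2 * x) + suc k + 3
    diagonal = trans (cong (λ z → z + d + 2 * (2 * x)) (sym (#tails-no-big (suc k)))) (tailsDiag-closed (suc k))
    regroup : ∀ d t x → d + t + 6 * (2 * x) + (1 + 2 * (2 * x)) ≡ (1 + d + 2 * (2 * x)) + (t + 6 * x) + 6 * x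
    regroup = solve-∀
    expand : ∀ k x c → (suc k * (2 * x) + suc k + 3) + (2 * k * x + c + 3) + 6 * x ≡
                       2 * suc k * (2 * x) + (c + (k + 3)) + 3 + (1 + 2 * (2 * x))
    expand = solve-∀

-- The count in the integer form used by the statement (n − 5 may be negative).
module IntegerCount where

  open Lengths using (#firstAtMost; length-firstAtMost)
  open Counting using (C3; #firstAtMost-closed)
  open CountedList using (countedList)
  open import Data.Nat using (suc; _≤_; _∸_; _^_; s≤s) renaming (_+_ to _+ℕ_; _*_ to _*ℕ_)
  open import Data.Nat.Properties using (+-comm)
  open import Data.Nat.Combinatorics using (_C_)
  open import Data.Integer using (+_; _-_; _*_) renaming (_+_ to _+ℤ_)
  open import Data.Integer.Properties using (pos-+; pos-*)
  open import Data.Integer.Tactic.RingSolver using (solve-∀)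
  open import Data.List using (length)
  open import Relation.Binary.PropositionalEquality using (_≡_; sym; trans; cong; cong₂; module ≡-Reasoning)

  count : ∀ n → 3 ≤ n → + length (countedList n) ≡ (+ n - + 5) * + (2 ^ (n ∸ 1)) +ℤ + ((n +ℕ 1) C 2) +ℤ + 3
  count (suc (suc k)) (s≤s (s≤s (s≤s _))) = begin
      + length (countedList (suc (suc k)))
    ≡⟨ cong (λ n → + length (CountedList.firstAtMost n k)) (+-comm 1 (suc k)) ⟩
      + length (CountedList.firstAtMost (suc k +ℕ 1) k)
    ≡⟨ cong +_ (length-firstAtMost k 1) ⟩
      + t
    ≡⟨ add-sub (+ t) (+ (6 *ℕ x)) ⟩
      (+ t +ℤ + (6 *ℕ x)) - + (6 *ℕ x)
    ≡⟨ cong (_- + (6 *ℕ x)) (trans (sym (pos-+ t (6 *ℕ x))) (cong +_ (#firstAtMost-closed k))) ⟩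
      + (2 *ℕ k *ℕ x +ℕ C3 k +ℕ 3) - + (6 *ℕ x)
    ≡⟨ cong₂ _-_ closed-form (pos-* 6 x) ⟩
      + 2 * + k * + x +ℤ + C3 k +ℤ + 3 - + 6 * + x
    ≡⟨ factor (+ k) (+ x) (+ C3 k) ⟩
      (+ k +ℤ + 2 - + 5) * (+ 2 * + x) +ℤ + C3 k +ℤ + 3
    ≡⟨ cong₂ (λ p q → (p - + 5) * q +ℤ + C3 k +ℤ + 3) (trans (sym (pos-+ k 2)) (cong +_ (+-comm k 2))) (sym (pos-* 2 x)) ⟩
      (+ suc (suc k) - + 5) * + (2 *ℕ x) +ℤ + C3 k +ℤ + 3
    ≡⟨ cong (λ z → (+ suc (suc k) - + 5) * + (2 *ℕ x) +ℤ + (z C 2) +ℤ + 3) (trans (+-comm k 3) (+-comm 1 (suc (suc k)))) ⟩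
      (+ suc (suc k) - + 5) * + (2 ^ (suc (suc k) ∸ 1)) +ℤ + ((suc (suc k) +ℕ 1) C 2) +ℤ + 3
    ∎
    where
    open ≡-Reasoning
    x = 2 ^ k
    t = #firstAtMost k 1
    closed-form : + (2 *ℕ k *ℕ x +ℕ C3 k +ℕ 3) ≡ + 2 * + k * + x +ℤ + C3 k +ℤ + 3
    closed-form = trans (pos-+ (2 *ℕ k *ℕ x +ℕ C3 k) 3) (cong (_+ℤ + 3)
      (trans (pos-+ (2 *ℕ k *ℕ x) (C3 k)) (cong (_+ℤ + C3 k) (trans (pos-* (2 *ℕ k) x) (cong (_* + x) (pos-* 2 k))))))
    add-sub : ∀ a b → a ≡ (a +ℤ b) - b
    add-sub = solve-∀
    factor : ∀ k x c → + 2 * k * x +ℤ c +ℤ + 3 - + 6 * x ≡ (k +ℤ + 2 - + 5) * (+ 2 * x) +ℤ c +ℤ + 3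
    factor = solve-∀


open import Defs
open import Data.Nat using (ℕ; _≤_; _+_; _∸_; _^_)
open import Data.Nat.Combinatorics using (_C_)
open import Data.Integer using (+_; _-_; _*_) renaming (_+_ to _+ℤ_)
open import Data.List using (length)
open import Data.List.Membership.Propositional using (_∈_)
open import Data.List.Relation.Unary.Unique.Propositional using (Unique)
open import Data.Product using (∃-syntax; _×_; _,_)
open import Function.Bundles using (_⇔_; mk⇔)
open import Relation.Binary.PropositionalEquality using (_≡_)

lemma3p2 : ∀ (n : ℕ) → 3 ≤ n →
    ∃[ L ] (Unique L × (∀ π → (π ∈ L) ⇔ Counted n π) ×
      + length L ≡ (+ n - + 5) * + (2 ^ (n ∸ 1)) +ℤ + ((n + 1) C 2) +ℤ + 3)
lemma3p2 n 3≤n =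
  CountedList.countedList n ,
  CountedList.unique-countedList n ,
  (λ π → mk⇔ (λ π∈ → Soundness.shape⇒counted n (CountedList.countedList⁻ n π∈))
             (λ counted → CountedList.countedList⁺ n (Completeness.counted⇒shape n counted))) ,
  IntegerCount.count n 3≤n
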